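{- Let $q$ be a prime power and let $j,n$ be positive integers with $1\le j\le n$. Let $p(n,j)$ be the number of monic polynomials $f$ of degree $n$ over $\mathbb F_q$ with nonzero constant coefficient such that $f$ has a self-reciprocal factor of degree $j$ and no self-reciprocal factor of higher degree. Then $p(n,j)=z(n-j)\,s(j)$, where for $m\ge 0$, $z(m)$ is the number of monic polynomials of degree $m$ over $\mathbb F_q$ with nonzero constant coefficient having no self-reciprocal factor other than the constant polynomial $1$, and $s(j)$ is the number of monic self-reciprocal polynomials of degree $j$ over $\mathbb F_q$.
   Context: For a polynomial $f$ of degree $n$ over $\mathbb F_q$ with nonzero constant coefficient, its reciprocal is $f^*(x)=x^n f(1/x)$. A polynomial $f$ with nonzero constant coefficient is called self-reciprocal if $f=f^*$. A self-reciprocal factor of $f$ is a polynomial $g$ dividing $f$ with $g=g^*$. -}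

module Defs where

open import Level using (0ℓ)
open import Data.Nat as ℕ using (ℕ; zero; suc; _∸_; _≤_; _<_)
open import Data.List using (List; []; _∷_; _++_; map; length; upTo)
open import Data.List.Membership.Propositional using (_∈_)
open import Data.List.Relation.Unary.Unique.Propositional using (Unique)
open import Data.Vec using (Vec; toList)
open import Data.Product using (Σ; ∃; ∃-syntax; _×_; _,_)
open import Relation.Binary.PropositionalEquality using (_≡_; _≢_)
open import Relation.Binary.Definitions using (DecidableEquality)
open import Relation.Nullary using (¬_)
open import Function.Bundles using (_⇔_)
open import Algebra.Structures using (IsCommutativeRing)

-- Its cardinality q (the length of a duplicate-free complete enumeration)
-- is automatically a prime power; conversely every prime power arises.
record FiniteField : Set₁ where
  field
    F   : Set
    _+_ : F → F → F
    _*_ : F → F → F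
    -_  : F → F
    0#  : F
    1#  : F
    isCommutativeRing : IsCommutativeRing _≡_ _+_ _*_ -_ 0# 1#
    0≢1      : 0# ≢ 1#
    inverse  : ∀ x → x ≢ 0# → ∃[ y ] (x * y ≡ 1#)
    _≟_      : DecidableEquality F
    elements : List F
    complete : ∀ x → x ∈ elements

module Polynomials (𝔽 : FiniteField) where
  open FiniteField 𝔽

  -- Polynomials over F as ascending coefficient lists
  -- (trailing zeros allowed; equality is coefficientwise).
  Poly : Set
  Poly = List F

  coeff : Poly → ℕ → F
  coeff []       _       = 0#
  coeff (a ∷ p)  zero    = a
  coeff (a ∷ p)  (suc i) = coeff p i

  _≈ₚ_ : Poly → Poly → Set
  p ≈ₚ r = ∀ i → coeff p i ≡ coeff r i

  _+ₚ_ : Poly → Poly → Poly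
  []      +ₚ r       = r
  (a ∷ p) +ₚ []      = a ∷ p
  (a ∷ p) +ₚ (b ∷ r) = (a + b) ∷ (p +ₚ r)

  scale : F → Poly → Poly
  scale a p = map (a *_) p

  _*ₚ_ : Poly → Poly → Poly
  []      *ₚ r = []
  (a ∷ p) *ₚ r = scale a r +ₚ (0# ∷ (p *ₚ r))

  _∣ₚ_ : Poly → Poly → Set
  g ∣ₚ f = ∃[ h ] ((g *ₚ h) ≈ₚ f)

  HasDegree : Poly → ℕ → Set
  HasDegree p d = (coeff p d ≢ 0#) × (∀ i → d < i → coeff p i ≡ 0#)

  -- reciprocal x^n f(1/x) of a polynomial f of degree n
  reciprocal : ℕ → Poly → Poly
  reciprocal n f = map (λ i → coeff f (n ∸ i)) (upTo (suc n))

  SelfReciprocal : Poly → Set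
  SelfReciprocal f = (coeff f 0 ≢ 0#) × ∃[ n ] (HasDegree f n × (f ≈ₚ reciprocal n f))

  -- the monic polynomial x^n + c_{n-1} x^{n-1} + ... + c_0 from (c_0,...,c_{n-1})
  monic : ∀ {n} → Vec F n → Poly
  monic v = toList v ++ (1# ∷ [])

  SRFactorOfDegree : Poly → ℕ → Set
  SRFactorOfDegree f d = ∃[ g ] ((g ∣ₚ f) × SelfReciprocal g × HasDegree g d)

  PSet : (n j : ℕ) → Vec F n → Set
  PSet n j v = (coeff (monic v) 0 ≢ 0#)
             × SRFactorOfDegree (monic v) j
             × (∀ d → SRFactorOfDegree (monic v) d → d ≤ j)

  ZSet : (m : ℕ) → Vec F m → Set
  ZSet m v = (coeff (monic v) 0 ≢ 0#)
           × (∀ d → SRFactorOfDegree (monic v) d → d ≡ 0)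

  SSet : (j : ℕ) → Vec F j → Set
  SSet j v = SelfReciprocal (monic v)

-- "L is a duplicate-free list of exactly the elements satisfying P",
-- so that length L is the number of such elements.
Enumerates : {A : Set} → (A → Set) → List A → Set
Enumerates P L = Unique L × (∀ x → (x ∈ L) ⇔ P x)

-- Multiplication (h, g) ↦ h g is a bijection from pairs of a monic self-reciprocal-free h
-- of degree n - j and a monic self-reciprocal g of degree j onto the polynomials counted
-- by p(n, j).  The crux is that a self-reciprocal divisor k of h g already divides g:
-- writing k = d k′ and g = d g′ with k′, g′ coprime (Bézout), the reciprocals satisfy
-- k′* = c k′ and g′* = c g′ for one constant c with c² = 1.  If c = 1 then k′ is a
-- self-reciprocal factor of h, hence constant; if c = -1 ≠ 1 then k′(1) = g′(1) = 0,
-- contradicting coprimality.  Conversely, the cofactor of a self-reciprocal factor of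
-- maximal degree is self-reciprocal-free, as otherwise their product would be larger.

module Submission where

open import Defs
open import Data.Nat using (ℕ; _≤_; _∸_; _*_)
open import Data.List using (List; length)
open import Data.Vec using (Vec)
open import Relation.Binary.PropositionalEquality using (_≡_)

open import Level using (0ℓ)
open import Algebra.Bundles using (CommutativeRing; CommutativeSemiring)
import Algebra.Properties.AbelianGroup as AbelianGroupProperties
import Algebra.Properties.CommutativeSemigroup as CommutativeSemigroupProperties
import Algebra.Properties.Ring as RingProperties
import Algebra.Solver.Ring.NaturalCoefficients.Default as Solver
open import Data.Empty using (⊥; ⊥-elim)
open import Data.Nat as ℕ using (zero; suc; _<_; z≤n; s≤s)
import Data.Nat.Properties as ℕ
open import Data.List using ([]; _∷_; map; applyUpTo; cartesianProduct)
import Data.List.Properties as List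
open import Data.List.Membership.Propositional using (_∈_)
import Data.List.Membership.Propositional.Properties as Membership
open import Data.List.Membership.Propositional.Properties.WithK using (unique∧set⇒bag)
open import Data.List.Relation.Binary.BagAndSetEquality using (∼bag⇒↭)
open import Data.List.Relation.Binary.Permutation.Propositional.Properties using (↭-length)
open import Data.List.Relation.Unary.All as All using (All; []; _∷_)
import Data.List.Relation.Unary.All.Properties as All
open import Data.List.Relation.Unary.AllPairs using ([]; _∷_)
open import Data.List.Relation.Unary.Unique.Propositional using (Unique)
import Data.List.Relation.Unary.Unique.Propositional.Properties as Unique
open import Data.Product using (∃-syntax; ∃₂; _×_; _,_; proj₁; proj₂; uncurry)
open import Data.Sum using (_⊎_; inj₁; inj₂; [_,_]′)
open import Data.Vec using () renaming ([] to []ᵥ; _∷_ to _∷ᵥ_)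
open import Function using (id; _∘_; _$_)
open import Function.Bundles using (_⇔_; mk⇔; Equivalence)
open import Relation.Nullary using (¬_; yes; no)
open import Relation.Binary.Bundles using (Setoid)
open import Relation.Binary.Definitions using (tri<; tri≈; tri>)
import Relation.Binary.Reasoning.Setoid as SetoidReasoning
open import Relation.Binary.PropositionalEquality
  using (_≢_; refl; sym; trans; cong; cong₂; subst; module ≡-Reasoning)

private variable A B C : Set

length-cartesianProduct : (xs : List A) (ys : List B) → length (cartesianProduct xs ys) ≡ length xs * length ys
length-cartesianProduct []       ys = refl
length-cartesianProduct (x ∷ xs) ys = trans (List.length-++ (map (x ,_) ys))
  (cong₂ ℕ._+_ (List.length-map (x ,_) ys) (length-cartesianProduct xs ys))

unique-map⁺ : ∀ {P : A → Set} {xs} (f : A → B) → (∀ {x y} → P x → P y → f x ≡ f y → x ≡ y) →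
              All P xs → Unique xs → Unique (map f xs)
unique-map⁺ f inj []         []          = []
unique-map⁺ f inj (px ∷ pxs) (x∉ ∷ xs!) =
  All.map⁺ (All.zipWith (λ (py , x≢y) fx≡fy → x≢y (inj px py fx≡fy)) (pxs , x∉)) ∷ unique-map⁺ f inj pxs xs!

enumerates-product : ∀ {P : A → Set} {Q : B → Set} {R : C → Set} {Lp Lq Lr} (f : A → B → C) →
  Enumerates P Lp → Enumerates Q Lq → Enumerates R Lr →
  (∀ a b → P a → Q b → R (f a b)) →
  (∀ {c} → R c → ∃₂ λ a b → P a × Q b × f a b ≡ c) →
  (∀ a b a′ b′ → P a → Q b → P a′ → Q b′ → f a b ≡ f a′ b′ → a ≡ a′ × b ≡ b′) →
  length Lr ≡ length Lp * length Lq
enumerates-product {P = P} {Q} {Lp = Lp} {Lq} {Lr} f (Lp! , ∈Lp) (Lq! , ∈Lq) (Lr! , ∈Lr) into onto inj = begin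
  length Lr                     ≡⟨ ↭-length (∼bag⇒↭ (unique∧set⇒bag Lr! image! same)) ⟩
  length (map (uncurry f) pairs) ≡⟨ List.length-map (uncurry f) pairs ⟩
  length pairs                  ≡⟨ length-cartesianProduct Lp Lq ⟩
  length Lp * length Lq         ∎
  where
  open ≡-Reasoning
  pairs = cartesianProduct Lp Lq
  in-pairs : ∀ {x} → x ∈ pairs → P (proj₁ x) × Q (proj₂ x)
  in-pairs x∈ with Membership.∈-cartesianProduct⁻ Lp Lq x∈
  ... | a∈ , b∈ = Equivalence.to (∈Lp _) a∈ , Equivalence.to (∈Lq _) b∈
  image! : Unique (map (uncurry f) pairs)
  image! = unique-map⁺ (uncurry f) (λ (pa , qb) (pa′ , qb′) e → let (a≡ , b≡) = inj _ _ _ _ pa qb pa′ qb′ e in cong₂ _,_ a≡ b≡)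
             (All.tabulate in-pairs) (Unique.cartesianProduct⁺ Lp! Lq!)
  image⊆Lr : ∀ {c} → c ∈ map (uncurry f) pairs → c ∈ Lr
  image⊆Lr c∈ with Membership.∈-map⁻ (uncurry f) c∈
  ... | (a , b) , ab∈ , refl = let (pa , qb) = in-pairs ab∈ in Equivalence.from (∈Lr _) (into a b pa qb)
  Lr⊆image : ∀ {c} → c ∈ Lr → c ∈ map (uncurry f) pairs
  Lr⊆image c∈ with onto (Equivalence.to (∈Lr _) c∈)
  ... | a , b , pa , qb , refl =
    Membership.∈-map⁺ (uncurry f) (Membership.∈-cartesianProduct⁺ (Equivalence.from (∈Lp a) pa) (Equivalence.from (∈Lq b) qb))
  same : ∀ {c} → (c ∈ Lr) ⇔ (c ∈ map (uncurry f) pairs)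
  same = mk⇔ Lr⊆image image⊆Lr

module SelfReciprocalFactors (𝔽 : FiniteField) where
  open FiniteField 𝔽 using (F; 0≢1; inverse; _≟_; isCommutativeRing)

  coefficientRing : CommutativeRing 0ℓ 0ℓ
  coefficientRing = record { isCommutativeRing = isCommutativeRing }

  open CommutativeRing coefficientRing
    using ( _+_; -_; 0#; 1#; +-abelianGroup; +-commutativeSemigroup
          ; +-assoc; +-comm; +-identityˡ; +-identityʳ; -‿inverseˡ; -‿inverseʳ
          ; *-assoc; *-comm; *-identityˡ; *-identityʳ; distribˡ; distribʳ; zeroˡ; zeroʳ )
    renaming (_*_ to _·_)
  open RingProperties (CommutativeRing.ring coefficientRing) using (-‿distribˡ-*; -1*x≈-x)
  open AbelianGroupProperties +-abelianGroup using (inverseˡ-unique; x∙y⁻¹≈ε⇒x≈y)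
  open CommutativeSemigroupProperties +-commutativeSemigroup using (interchange)
  open Polynomials 𝔽

  -- Arithmetic in the field

  module _ where
    open ≡-Reasoning

    1≢0 : 1# ≢ 0#
    1≢0 e = 0≢1 (sym e)

    x·y≡0⇒x≡0⊎y≡0 : ∀ x y → x · y ≡ 0# → x ≡ 0# ⊎ y ≡ 0#
    x·y≡0⇒x≡0⊎y≡0 x y xy≡0 with x ≟ 0#
    ... | yes x≡0 = inj₁ x≡0
    ... | no x≢0 with inverse x x≢0
    ... | x⁻¹ , xx⁻¹≡1 = inj₂ (begin
      y               ≡⟨ sym (*-identityˡ y) ⟩
      1# · y          ≡⟨ cong (_· y) (sym xx⁻¹≡1) ⟩
      (x · x⁻¹) · y   ≡⟨ cong (_· y) (*-comm x x⁻¹) ⟩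
      (x⁻¹ · x) · y   ≡⟨ *-assoc x⁻¹ x y ⟩
      x⁻¹ · (x · y)   ≡⟨ cong (x⁻¹ ·_) xy≡0 ⟩
      x⁻¹ · 0#        ≡⟨ zeroʳ x⁻¹ ⟩
      0#              ∎)

    ·-nonZero : ∀ {x y} → x ≢ 0# → y ≢ 0# → x · y ≢ 0#
    ·-nonZero {x} {y} x≢0 y≢0 xy≡0 with x·y≡0⇒x≡0⊎y≡0 x y xy≡0
    ... | inj₁ x≡0 = x≢0 x≡0
    ... | inj₂ y≡0 = y≢0 y≡0

    [x-y]·z≡x·z-y·z : ∀ x y z → (x + - y) · z ≡ x · z + - (y · z)
    [x-y]·z≡x·z-y·z x y z = trans (distribʳ z x (- y)) (cong (x · z +_) (sym (-‿distribˡ-* y z)))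

    ·-cancelʳ : ∀ {z} x y → z ≢ 0# → x · z ≡ y · z → x ≡ y
    ·-cancelʳ {z} x y z≢0 xz≡yz with x·y≡0⇒x≡0⊎y≡0 (x + - y) z (begin
      (x + - y) · z       ≡⟨ [x-y]·z≡x·z-y·z x y z ⟩
      x · z + - (y · z)   ≡⟨ cong (_+ - (y · z)) xz≡yz ⟩
      y · z + - (y · z)   ≡⟨ -‿inverseʳ (y · z) ⟩
      0#                  ∎)
    ... | inj₁ x-y≡0 = x∙y⁻¹≈ε⇒x≈y x y x-y≡0
    ... | inj₂ z≡0 = ⊥-elim (z≢0 z≡0)

    x·x≡1⇒x≡±1 : ∀ x → x · x ≡ 1# → x ≡ 1# ⊎ x ≡ - 1#
    x·x≡1⇒x≡±1 x xx≡1 with x·y≡0⇒x≡0⊎y≡0 (x + - 1#) (x + 1#) (begin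
      (x + - 1#) · (x + 1#)              ≡⟨ [x-y]·z≡x·z-y·z x 1# (x + 1#) ⟩
      x · (x + 1#) + - (1# · (x + 1#))   ≡⟨ cong₂ (λ a b → a + - b) (distribˡ x x 1#) (*-identityˡ (x + 1#)) ⟩
      (x · x + x · 1#) + - (x + 1#)      ≡⟨ cong (λ a → (a + x · 1#) + - (x + 1#)) xx≡1 ⟩
      (1# + x · 1#) + - (x + 1#)         ≡⟨ cong (λ a → (1# + a) + - (x + 1#)) (*-identityʳ x) ⟩
      (1# + x) + - (x + 1#)              ≡⟨ cong (_+ - (x + 1#)) (+-comm 1# x) ⟩
      (x + 1#) + - (x + 1#)              ≡⟨ -‿inverseʳ (x + 1#) ⟩
      0#                                 ∎)
    ... | inj₁ x-1≡0 = inj₁ (x∙y⁻¹≈ε⇒x≈y x 1# x-1≡0)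
    ... | inj₂ x+1≡0 = inj₂ (inverseˡ-unique x 1# x+1≡0)

    x≡-x⇒x≡0 : ∀ {x} → - 1# ≢ 1# → x ≡ - x → x ≡ 0#
    x≡-x⇒x≡0 {x} -1≢1 x≡-x with x·y≡0⇒x≡0⊎y≡0 (1# + 1#) x (begin
      (1# + 1#) · x       ≡⟨ distribʳ x 1# 1# ⟩
      1# · x + 1# · x     ≡⟨ cong₂ _+_ (trans (*-identityˡ x) x≡-x) (*-identityˡ x) ⟩
      - x + x             ≡⟨ -‿inverseˡ x ⟩
      0#                  ∎)
    ... | inj₁ 1+1≡0 = ⊥-elim (-1≢1 (sym (inverseˡ-unique 1# 1# 1+1≡0)))
    ... | inj₂ x≡0 = x≡0

  -- The semiring of polynomials up to coefficientwise equality

  -- A record rather than the bare _≈ₚ_, so that both polynomials can be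
  -- inferred from an equality proof.
  record _≋_ (p r : Poly) : Set where
    constructor mk≋
    field coeff-≡ : p ≈ₚ r
  open _≋_ public
  infix 4 _≋_

  ≋-refl : ∀ {p} → p ≋ p
  ≋-refl = mk≋ λ _ → refl

  ≋-sym : ∀ {p r} → p ≋ r → r ≋ p
  ≋-sym p≋r = mk≋ λ i → sym (coeff-≡ p≋r i)

  ≋-trans : ∀ {p r s} → p ≋ r → r ≋ s → p ≋ s
  ≋-trans p≋r r≋s = mk≋ λ i → trans (coeff-≡ p≋r i) (coeff-≡ r≋s i)

  ≋-setoid : Setoid 0ℓ 0ℓ
  ≋-setoid = record { Carrier = Poly ; _≈_ = _≋_ ; isEquivalence = record { refl = ≋-refl ; sym = ≋-sym ; trans = ≋-trans } }

  module ≋-Reasoning = SetoidReasoning ≋-setoid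

  divX : Poly → Poly
  divX []      = []
  divX (_ ∷ p) = p

  coeff-suc : ∀ p i → coeff p (suc i) ≡ coeff (divX p) i
  coeff-suc []      i = refl
  coeff-suc (a ∷ p) i = refl

  coeff-+ₚ : ∀ p r i → coeff (p +ₚ r) i ≡ coeff p i + coeff r i
  coeff-+ₚ []      r       i       = sym (+-identityˡ _)
  coeff-+ₚ (a ∷ p) []      i       = sym (+-identityʳ _)
  coeff-+ₚ (a ∷ p) (b ∷ r) zero    = refl
  coeff-+ₚ (a ∷ p) (b ∷ r) (suc i) = coeff-+ₚ p r i

  coeff-scale : ∀ a p i → coeff (scale a p) i ≡ a · coeff p i
  coeff-scale a []      i       = sym (zeroʳ a)
  coeff-scale a (b ∷ p) zero    = refl
  coeff-scale a (b ∷ p) (suc i) = coeff-scale a p i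

  coeff-*ₚ-zero : ∀ p r → coeff (p *ₚ r) 0 ≡ coeff p 0 · coeff r 0
  coeff-*ₚ-zero []      r = sym (zeroˡ _)
  coeff-*ₚ-zero (a ∷ p) r = trans (coeff-+ₚ (scale a r) (0# ∷ (p *ₚ r)) 0)
                                  (trans (+-identityʳ _) (coeff-scale a r 0))

  coeff-*ₚ-suc : ∀ p r i → coeff (p *ₚ r) (suc i) ≡ coeff p 0 · coeff r (suc i) + coeff (divX p *ₚ r) i
  coeff-*ₚ-suc []      r i = sym (trans (cong (_+ 0#) (zeroˡ _)) (+-identityʳ 0#))
  coeff-*ₚ-suc (a ∷ p) r i = trans (coeff-+ₚ (scale a r) (0# ∷ (p *ₚ r)) (suc i))
                                   (cong (_+ coeff (p *ₚ r) i) (coeff-scale a r (suc i)))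

  divX-cong : ∀ {p r} → p ≋ r → divX p ≋ divX r
  divX-cong {p} {r} p≋r = mk≋ λ i → trans (sym (coeff-suc p i)) (trans (coeff-≡ p≋r (suc i)) (coeff-suc r i))

  ∷-cong : ∀ {a b p r} → a ≡ b → p ≋ r → (a ∷ p) ≋ (b ∷ r)
  ∷-cong a≡b p≋r = mk≋ λ { zero → a≡b ; (suc i) → coeff-≡ p≋r i }

  +ₚ-cong : ∀ {p p′ r r′} → p ≋ p′ → r ≋ r′ → (p +ₚ r) ≋ (p′ +ₚ r′)
  +ₚ-cong {p} {p′} {r} {r′} p≋p′ r≋r′ = mk≋ λ i →
    trans (coeff-+ₚ p r i) (trans (cong₂ _+_ (coeff-≡ p≋p′ i) (coeff-≡ r≋r′ i)) (sym (coeff-+ₚ p′ r′ i)))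

  scale-cong : ∀ {a b p r} → a ≡ b → p ≋ r → scale a p ≋ scale b r
  scale-cong {a} {b} {p} {r} a≡b p≋r = mk≋ λ i →
    trans (coeff-scale a p i) (trans (cong₂ _·_ a≡b (coeff-≡ p≋r i)) (sym (coeff-scale b r i)))

  *ₚ-congˡ : ∀ {p p′} r → p ≋ p′ → (p *ₚ r) ≋ (p′ *ₚ r)
  *ₚ-congˡ r p≋p′ = mk≋ (go p≋p′)
    where
    go : ∀ {p p′} → p ≋ p′ → ∀ i → coeff (p *ₚ r) i ≡ coeff (p′ *ₚ r) i
    go {p} {p′} p≋p′ zero    = trans (coeff-*ₚ-zero p r)
      (trans (cong (_· coeff r 0) (coeff-≡ p≋p′ 0)) (sym (coeff-*ₚ-zero p′ r)))
    go {p} {p′} p≋p′ (suc i) = trans (coeff-*ₚ-suc p r i)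
      (trans (cong₂ _+_ (cong (_· coeff r (suc i)) (coeff-≡ p≋p′ 0)) (go (divX-cong p≋p′) i))
             (sym (coeff-*ₚ-suc p′ r i)))

  *ₚ-congʳ : ∀ p {r r′} → r ≋ r′ → (p *ₚ r) ≋ (p *ₚ r′)
  *ₚ-congʳ p {r} {r′} r≋r′ = mk≋ (go p)
    where
    go : ∀ p i → coeff (p *ₚ r) i ≡ coeff (p *ₚ r′) i
    go p zero    = trans (coeff-*ₚ-zero p r) (trans (cong (coeff p 0 ·_) (coeff-≡ r≋r′ 0)) (sym (coeff-*ₚ-zero p r′)))
    go p (suc i) = trans (coeff-*ₚ-suc p r i)
      (trans (cong₂ _+_ (cong (coeff p 0 ·_) (coeff-≡ r≋r′ (suc i))) (go (divX p) i)) (sym (coeff-*ₚ-suc p r′ i)))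

  *ₚ-cong : ∀ {p p′ r r′} → p ≋ p′ → r ≋ r′ → (p *ₚ r) ≋ (p′ *ₚ r′)
  *ₚ-cong {p′ = p′} {r} p≋p′ r≋r′ = ≋-trans (*ₚ-congˡ r p≋p′) (*ₚ-congʳ p′ r≋r′)

  1ₚ : Poly
  1ₚ = 1# ∷ []

  constant : F → Poly
  constant c = c ∷ []

  +ₚ-comm : ∀ p r → (p +ₚ r) ≋ (r +ₚ p)
  +ₚ-comm p r = mk≋ λ i → trans (coeff-+ₚ p r i) (trans (+-comm _ _) (sym (coeff-+ₚ r p i)))

  +ₚ-assoc : ∀ p r s → ((p +ₚ r) +ₚ s) ≋ (p +ₚ (r +ₚ s))
  +ₚ-assoc p r s = mk≋ λ i → begin
    coeff ((p +ₚ r) +ₚ s) i               ≡⟨ trans (coeff-+ₚ (p +ₚ r) s i) (cong (_+ coeff s i) (coeff-+ₚ p r i)) ⟩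
    (coeff p i + coeff r i) + coeff s i   ≡⟨ +-assoc _ _ _ ⟩
    coeff p i + (coeff r i + coeff s i)   ≡⟨ sym (trans (coeff-+ₚ p (r +ₚ s) i) (cong (coeff p i +_) (coeff-+ₚ r s i))) ⟩
    coeff (p +ₚ (r +ₚ s)) i               ∎
    where open ≡-Reasoning

  +ₚ-identityʳ : ∀ p → (p +ₚ []) ≋ p
  +ₚ-identityʳ p = mk≋ λ i → trans (coeff-+ₚ p [] i) (+-identityʳ _)

  0∷-+ₚ : ∀ p r → (0# ∷ (p +ₚ r)) ≋ ((0# ∷ p) +ₚ (0# ∷ r))
  0∷-+ₚ p r = ∷-cong (sym (+-identityʳ 0#)) ≋-refl

  scale-zero : ∀ p → scale 0# p ≋ []
  scale-zero p = mk≋ λ i → trans (coeff-scale 0# p i) (zeroˡ _)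

  scale-one : ∀ p → scale 1# p ≋ p
  scale-one p = mk≋ λ i → trans (coeff-scale 1# p i) (*-identityˡ _)

  scale-scale : ∀ a b p → scale a (scale b p) ≋ scale (a · b) p
  scale-scale a b p = mk≋ λ i → trans (coeff-scale a (scale b p) i)
    (trans (cong (a ·_) (coeff-scale b p i)) (trans (sym (*-assoc a b _)) (sym (coeff-scale (a · b) p i))))

  scale-distribˡ : ∀ a p r → scale a (p +ₚ r) ≋ (scale a p +ₚ scale a r)
  scale-distribˡ a p r = mk≋ λ i → trans (coeff-scale a (p +ₚ r) i)
    (trans (cong (a ·_) (coeff-+ₚ p r i)) (trans (distribˡ a _ _)
    (trans (cong₂ _+_ (sym (coeff-scale a p i)) (sym (coeff-scale a r i))) (sym (coeff-+ₚ (scale a p) (scale a r) i)))))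

  scale-distribʳ : ∀ a b p → scale (a + b) p ≋ (scale a p +ₚ scale b p)
  scale-distribʳ a b p = mk≋ λ i → trans (coeff-scale (a + b) p i) (trans (distribʳ _ a b)
    (trans (cong₂ _+_ (sym (coeff-scale a p i)) (sym (coeff-scale b p i))) (sym (coeff-+ₚ (scale a p) (scale b p) i))))

  0∷-scale : ∀ a p → (0# ∷ scale a p) ≋ scale a (0# ∷ p)
  0∷-scale a p = ∷-cong (sym (zeroʳ a)) ≋-refl

  0∷-*ₚ : ∀ p r → ((0# ∷ p) *ₚ r) ≋ (0# ∷ (p *ₚ r))
  0∷-*ₚ p r = +ₚ-cong (scale-zero r) ≋-refl

  0∷[]≋[] : (0# ∷ []) ≋ []
  0∷[]≋[] = mk≋ λ { zero → refl ; (suc i) → refl }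

  constant-*ₚ : ∀ c p → (constant c *ₚ p) ≋ scale c p
  constant-*ₚ c p = ≋-trans (+ₚ-cong ≋-refl 0∷[]≋[]) (+ₚ-identityʳ (scale c p))

  *ₚ-zeroʳ : ∀ p → (p *ₚ []) ≋ []
  *ₚ-zeroʳ p = mk≋ (go p)
    where
    go : ∀ p i → coeff (p *ₚ []) i ≡ 0#
    go p zero    = trans (coeff-*ₚ-zero p []) (zeroʳ _)
    go p (suc i) = trans (coeff-*ₚ-suc p [] i) (trans (cong₂ _+_ (zeroʳ _) (go (divX p) i)) (+-identityʳ 0#))

  +ₚ-left-comm : ∀ p r s → (p +ₚ (r +ₚ s)) ≋ (r +ₚ (p +ₚ s))
  +ₚ-left-comm p r s = begin
    p +ₚ (r +ₚ s)   ≈⟨ +ₚ-assoc p r s ⟨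
    (p +ₚ r) +ₚ s   ≈⟨ +ₚ-cong (+ₚ-comm p r) ≋-refl ⟩
    (r +ₚ p) +ₚ s   ≈⟨ +ₚ-assoc r p s ⟩
    r +ₚ (p +ₚ s)   ∎
    where open ≋-Reasoning

  *ₚ-∷ : ∀ p b r → (p *ₚ (b ∷ r)) ≋ (scale b p +ₚ (0# ∷ (p *ₚ r)))
  *ₚ-∷ []      b r = ≋-sym 0∷[]≋[]
  *ₚ-∷ (a ∷ p) b r = ∷-cong (cong (_+ 0#) (*-comm a b)) (begin
    scale a r +ₚ (p *ₚ (b ∷ r))                      ≈⟨ +ₚ-cong ≋-refl (*ₚ-∷ p b r) ⟩
    scale a r +ₚ (scale b p +ₚ (0# ∷ (p *ₚ r)))      ≈⟨ +ₚ-left-comm (scale a r) (scale b p) _ ⟩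
    scale b p +ₚ (scale a r +ₚ (0# ∷ (p *ₚ r)))      ∎)
    where open ≋-Reasoning

  *ₚ-comm : ∀ p r → (p *ₚ r) ≋ (r *ₚ p)
  *ₚ-comm []      r = ≋-sym (*ₚ-zeroʳ r)
  *ₚ-comm (a ∷ p) r = ≋-trans (+ₚ-cong ≋-refl (∷-cong refl (*ₚ-comm p r))) (≋-sym (*ₚ-∷ r a p))

  *ₚ-distribʳ : ∀ p r s → ((p +ₚ r) *ₚ s) ≋ ((p *ₚ s) +ₚ (r *ₚ s))
  *ₚ-distribʳ []      r       s = ≋-refl
  *ₚ-distribʳ (a ∷ p) []      s = ≋-sym (+ₚ-identityʳ _)
  *ₚ-distribʳ (a ∷ p) (b ∷ r) s = begin
    scale (a + b) s +ₚ (0# ∷ ((p +ₚ r) *ₚ s))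
      ≈⟨ +ₚ-cong (scale-distribʳ a b s) (≋-trans (∷-cong refl (*ₚ-distribʳ p r s)) (0∷-+ₚ (p *ₚ s) (r *ₚ s))) ⟩
    (scale a s +ₚ scale b s) +ₚ ((0# ∷ (p *ₚ s)) +ₚ (0# ∷ (r *ₚ s)))
      ≈⟨ +ₚ-assoc (scale a s) _ _ ⟩
    scale a s +ₚ (scale b s +ₚ ((0# ∷ (p *ₚ s)) +ₚ (0# ∷ (r *ₚ s))))
      ≈⟨ +ₚ-cong (≋-refl {scale a s}) (+ₚ-left-comm (scale b s) (0# ∷ (p *ₚ s)) (0# ∷ (r *ₚ s))) ⟩
    scale a s +ₚ ((0# ∷ (p *ₚ s)) +ₚ (scale b s +ₚ (0# ∷ (r *ₚ s))))
      ≈⟨ +ₚ-assoc (scale a s) _ _ ⟨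
    (scale a s +ₚ (0# ∷ (p *ₚ s))) +ₚ (scale b s +ₚ (0# ∷ (r *ₚ s))) ∎
    where open ≋-Reasoning

  scale-*ₚ : ∀ a p r → (scale a p *ₚ r) ≋ scale a (p *ₚ r)
  scale-*ₚ a []      r = ≋-refl
  scale-*ₚ a (b ∷ p) r = begin
    scale (a · b) r +ₚ (0# ∷ (scale a p *ₚ r))       ≈⟨ +ₚ-cong (≋-sym (scale-scale a b r)) (∷-cong refl (scale-*ₚ a p r)) ⟩
    scale a (scale b r) +ₚ (0# ∷ scale a (p *ₚ r))   ≈⟨ +ₚ-cong ≋-refl (0∷-scale a (p *ₚ r)) ⟩
    scale a (scale b r) +ₚ scale a (0# ∷ (p *ₚ r))   ≈⟨ scale-distribˡ a (scale b r) _ ⟨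
    scale a (scale b r +ₚ (0# ∷ (p *ₚ r)))           ∎
    where open ≋-Reasoning

  *ₚ-scale : ∀ a p r → (p *ₚ scale a r) ≋ scale a (p *ₚ r)
  *ₚ-scale a p r = ≋-trans (*ₚ-comm p (scale a r)) (≋-trans (scale-*ₚ a r p) (scale-cong refl (*ₚ-comm r p)))

  *ₚ-assoc : ∀ p r s → ((p *ₚ r) *ₚ s) ≋ (p *ₚ (r *ₚ s))
  *ₚ-assoc []      r s = ≋-refl
  *ₚ-assoc (a ∷ p) r s = begin
    (scale a r +ₚ (0# ∷ (p *ₚ r))) *ₚ s           ≈⟨ *ₚ-distribʳ (scale a r) _ s ⟩
    (scale a r *ₚ s) +ₚ ((0# ∷ (p *ₚ r)) *ₚ s)    ≈⟨ +ₚ-cong (scale-*ₚ a r s) (0∷-*ₚ (p *ₚ r) s) ⟩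
    scale a (r *ₚ s) +ₚ (0# ∷ ((p *ₚ r) *ₚ s))    ≈⟨ +ₚ-cong ≋-refl (∷-cong refl (*ₚ-assoc p r s)) ⟩
    scale a (r *ₚ s) +ₚ (0# ∷ (p *ₚ (r *ₚ s)))    ∎
    where open ≋-Reasoning

  *ₚ-identityˡ : ∀ p → (1ₚ *ₚ p) ≋ p
  *ₚ-identityˡ p = ≋-trans (constant-*ₚ 1# p) (scale-one p)

  *ₚ-identityʳ : ∀ p → (p *ₚ 1ₚ) ≋ p
  *ₚ-identityʳ p = ≋-trans (*ₚ-comm p 1ₚ) (*ₚ-identityˡ p)

  polynomialSemiring : CommutativeSemiring 0ℓ 0ℓ
  polynomialSemiring = record
    { Carrier = Poly ; _≈_ = _≋_ ; _+_ = _+ₚ_ ; _*_ = _*ₚ_ ; 0# = [] ; 1# = 1ₚ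
    ; isCommutativeSemiring = record
      { isSemiring = record
        { isSemiringWithoutAnnihilatingZero = record
          { +-isCommutativeMonoid = record
            { isMonoid = record
              { isSemigroup = record
                { isMagma = record
                  { isEquivalence = Setoid.isEquivalence ≋-setoid
                  ; ∙-cong = +ₚ-cong }
                ; assoc = +ₚ-assoc }
              ; identity = (λ _ → ≋-refl) , +ₚ-identityʳ }
            ; comm = +ₚ-comm }
          ; *-cong = *ₚ-cong
          ; *-assoc = *ₚ-assoc
          ; *-identity = *ₚ-identityˡ , *ₚ-identityʳ
          ; distrib = (λ p r s → ≋-trans (*ₚ-comm p (r +ₚ s))
                         (≋-trans (*ₚ-distribʳ r s p) (+ₚ-cong (*ₚ-comm r p) (*ₚ-comm s p))))
                    , (λ p r s → *ₚ-distribʳ r s p) }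
        ; zero = (λ _ → ≋-refl) , *ₚ-zeroʳ }
      ; *-comm = *ₚ-comm } }

  module PolySolver = Solver polynomialSemiring

  -- Degrees

  DegreeAtMost : Poly → ℕ → Set
  DegreeAtMost p d = ∀ i → d < i → coeff p i ≡ 0#

  DegreeBelow : Poly → ℕ → Set
  DegreeBelow p d = ∀ i → d ≤ i → coeff p i ≡ 0#

  record IsDegree (p : Poly) (d : ℕ) : Set where
    constructor isDegree
    field
      leading≢0    : coeff p d ≢ 0#
      degreeAtMost : DegreeAtMost p d
  open IsDegree public

  fromHasDegree : ∀ p {d} → HasDegree p d → IsDegree p d
  fromHasDegree p (lead≢0 , atMost) = isDegree lead≢0 atMost

  toHasDegree : ∀ {p d} → IsDegree p d → HasDegree p d
  toHasDegree (isDegree lead≢0 atMost) = lead≢0 , atMost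

  divX-degreeAtMost : ∀ p {d} → DegreeAtMost p (suc d) → DegreeAtMost (divX p) d
  divX-degreeAtMost p atMost i d<i = trans (sym (coeff-suc p i)) (atMost (suc i) (s≤s d<i))

  degreeAtMost-mono : ∀ p {m n} → DegreeAtMost p m → m ≤ n → DegreeAtMost p n
  degreeAtMost-mono p atMost m≤n i n<i = atMost i (ℕ.≤-<-trans m≤n n<i)

  degreeAtMost-zero : ∀ p → DegreeAtMost p 0 → p ≋ constant (coeff p 0)
  degreeAtMost-zero p atMost = mk≋ λ { zero → refl ; (suc i) → atMost (suc i) (s≤s z≤n) }

  degree-zero : ∀ {p} → IsDegree p 0 → p ≋ constant (coeff p 0)
  degree-zero {p} p° = degreeAtMost-zero p (degreeAtMost p°)

  degreeBelow-length : ∀ p → DegreeBelow p (length p)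
  degreeBelow-length []      i       _         = refl
  degreeBelow-length (a ∷ p) (suc i) (s≤s l≤i) = degreeBelow-length p i l≤i

  zero⊎degree : ∀ p → p ≋ [] ⊎ ∃[ d ] IsDegree p d
  zero⊎degree [] = inj₁ ≋-refl
  zero⊎degree (a ∷ p) with zero⊎degree p
  ... | inj₂ (d , isDegree lead≢0 atMost) =
    inj₂ (suc d , isDegree lead≢0 λ { (suc i) (s≤s d<i) → atMost i d<i })
  ... | inj₁ p≋0 with a ≟ 0#
  ...   | yes a≡0 = inj₁ (≋-trans (∷-cong a≡0 p≋0) 0∷[]≋[])
  ...   | no a≢0  = inj₂ (0 , isDegree a≢0 λ { (suc i) _ → coeff-≡ p≋0 i })

  degree⇒≉0 : ∀ {p d} → IsDegree p d → ¬ (p ≋ [])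
  degree⇒≉0 {d = d} p° p≋0 = leading≢0 p° (coeff-≡ p≋0 d)

  degree-unique : ∀ {p a b} → IsDegree p a → IsDegree p b → a ≡ b
  degree-unique {a = a} {b} (isDegree a≢0 ≤a) (isDegree b≢0 ≤b) with ℕ.<-cmp a b
  ... | tri< a<b _ _ = ⊥-elim (b≢0 (≤a b a<b))
  ... | tri≈ _ a≡b _ = a≡b
  ... | tri> _ _ b<a = ⊥-elim (a≢0 (≤b a b<a))

  IsDegree-resp-≋ : ∀ {p r d} → p ≋ r → IsDegree p d → IsDegree r d
  IsDegree-resp-≋ {d = d} p≋r (isDegree lead≢0 atMost) =
    isDegree (λ r≡0 → lead≢0 (trans (coeff-≡ p≋r d) r≡0)) (λ i d<i → trans (sym (coeff-≡ p≋r i)) (atMost i d<i))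

  *ₚ-degreeAtMost : ∀ a {b} p r → DegreeAtMost p a → DegreeAtMost r b →
                    DegreeAtMost (p *ₚ r) (a ℕ.+ b) × (coeff (p *ₚ r) (a ℕ.+ b) ≡ coeff p a · coeff r b)
  *ₚ-degreeAtMost zero {b} p r p≤0 r≤b =
    (λ i b<i → trans (coeff-*ₚ-const i) (trans (cong (coeff p 0 ·_) (r≤b i b<i)) (zeroʳ _))) , coeff-*ₚ-const b
    where
    coeff-*ₚ-const : ∀ i → coeff (p *ₚ r) i ≡ coeff p 0 · coeff r i
    coeff-*ₚ-const i = trans (coeff-≡ (≋-trans (*ₚ-congˡ r (degreeAtMost-zero p p≤0)) (constant-*ₚ (coeff p 0) r)) i)
                             (coeff-scale (coeff p 0) r i)

  *ₚ-degreeAtMost (suc a) {b} p r p≤a r≤b = atMost , top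
    where
    IH = *ₚ-degreeAtMost a (divX p) r (divX-degreeAtMost p p≤a) r≤b
    low : ∀ {i} → b < suc i → coeff p 0 · coeff r (suc i) ≡ 0#
    low b<i = trans (cong (coeff p 0 ·_) (r≤b _ b<i)) (zeroʳ _)
    atMost : DegreeAtMost (p *ₚ r) (suc a ℕ.+ b)
    atMost (suc i) (s≤s a+b<i) = trans (coeff-*ₚ-suc p r i)
      (trans (cong₂ _+_ (low (ℕ.<-≤-trans (s≤s (ℕ.m≤n+m b a)) (ℕ.≤-trans a+b<i (ℕ.n≤1+n i)))) (proj₁ IH i a+b<i))
             (+-identityʳ 0#))
    top : coeff (p *ₚ r) (suc a ℕ.+ b) ≡ coeff p (suc a) · coeff r b
    top = trans (coeff-*ₚ-suc p r (a ℕ.+ b))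
      (trans (cong₂ _+_ (low (s≤s (ℕ.m≤n+m b a))) (proj₂ IH))
             (trans (+-identityˡ _) (cong (_· coeff r b) (sym (coeff-suc p a)))))

  *ₚ-degree : ∀ {p r a b} → IsDegree p a → IsDegree r b → IsDegree (p *ₚ r) (a ℕ.+ b)
  *ₚ-degree {p} {r} {a} (isDegree p≢0 p≤a) (isDegree r≢0 r≤b) with *ₚ-degreeAtMost a p r p≤a r≤b
  ... | atMost , top = isDegree (λ top≡0 → ·-nonZero p≢0 r≢0 (trans (sym top) top≡0)) atMost

  -- Divisibility, division with remainder and Bézout's identity

  record _∣_ (g f : Poly) : Set where
    constructor divides
    field
      quotient : Poly
      equality : (g *ₚ quotient) ≋ f
  open _∣_ public

  fromDivides : ∀ {g f} → g ∣ₚ f → g ∣ f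
  fromDivides (h , gh≈f) = divides h (mk≋ gh≈f)

  toDivides : ∀ {g f} → g ∣ f → g ∣ₚ f
  toDivides (divides h gh≋f) = h , coeff-≡ gh≋f

  ∣-refl : ∀ g → g ∣ g
  ∣-refl g = divides 1ₚ (*ₚ-identityʳ g)

  ∣-respʳ-≋ : ∀ {g f f′} → f ≋ f′ → g ∣ f → g ∣ f′
  ∣-respʳ-≋ f≋f′ (divides h gh≋f) = divides h (≋-trans gh≋f f≋f′)

  ∣-*ₚʳ : ∀ {g f} s → g ∣ f → g ∣ (f *ₚ s)
  ∣-*ₚʳ {g} s (divides h gh≋f) = divides (h *ₚ s) (≋-trans (≋-sym (*ₚ-assoc g h s)) (*ₚ-congˡ s gh≋f))

  ∣-+ₚ : ∀ {g f f′} → g ∣ f → g ∣ f′ → g ∣ (f +ₚ f′)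
  ∣-+ₚ {g} (divides h gh≋f) (divides h′ gh′≋f′) =
    divides (h +ₚ h′) (≋-trans (PolySolver.solve 3 (λ g h h′ → g :* (h :+ h′) := g :* h :+ g :* h′) ≋-refl g h h′)
                               (+ₚ-cong gh≋f gh′≋f′))
    where open PolySolver using (_:+_; _:*_; _:=_)

  ∣⇒degree-≤ : ∀ {g f d n} → g ∣ f → IsDegree g d → IsDegree f n → d ≤ n
  ∣⇒degree-≤ {g} {d = d} (divides h gh≋f) g° f° with zero⊎degree h
  ... | inj₁ h≋0 = ⊥-elim (degree⇒≉0 f° (≋-trans (≋-sym gh≋f) (≋-trans (*ₚ-congʳ g h≋0) (*ₚ-zeroʳ g))))
  ... | inj₂ (e , h°) with degree-unique (IsDegree-resp-≋ gh≋f (*ₚ-degree g° h°)) f°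
  ... | refl = ℕ.m≤m+n d e

  -1ₚ : Poly
  -1ₚ = constant (- 1#)

  +ₚ-inverseʳ : ∀ p → (p +ₚ (-1ₚ *ₚ p)) ≋ []
  +ₚ-inverseʳ p = mk≋ λ i → trans (coeff-+ₚ p (-1ₚ *ₚ p) i)
    (trans (cong (coeff p i +_) (trans (coeff-≡ (constant-*ₚ (- 1#) p) i)
                                 (trans (coeff-scale (- 1#) p i) (-1*x≈-x _))))
           (-‿inverseʳ _))

  record Division (g f : Poly) (e : ℕ) : Set where
    constructor division
    field
      quotient  : Poly
      remainder : Poly
      division-equality : ((g *ₚ quotient) +ₚ remainder) ≋ f
      remainder-degree  : DegreeBelow remainder e

  divide : ∀ {g e} → IsDegree g e → ∀ f → Division g f e
  divide {g} g° [] = division [] [] (≋-trans (+ₚ-identityʳ _) (*ₚ-zeroʳ g)) (λ _ _ → refl)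
  divide {g} {e} g° (a ∷ f) with divide g° f | inverse (coeff g e) (leading≢0 g°)
  ... | division q r gq+r≋f r<e | lc⁻¹ , lc·lc⁻¹≡1 = division (t ∷ q) (s +ₚ scale (- t) g) equality′ below
    where
    -- a ∷ f = x (g q) + (a ∷ r), and subtracting t g clears the x^e coefficient of a ∷ r.
    s = a ∷ r
    t = coeff s e · lc⁻¹
    tg-tg≋0 : (scale t g +ₚ scale (- t) g) ≋ []
    tg-tg≋0 = ≋-trans (≋-sym (scale-distribʳ t (- t) g))
                      (≋-trans (scale-cong (-‿inverseʳ t) ≋-refl) (scale-zero g))
    equality′ : ((g *ₚ (t ∷ q)) +ₚ (s +ₚ scale (- t) g)) ≋ (a ∷ f)
    equality′ = begin
      (g *ₚ (t ∷ q)) +ₚ (s +ₚ scale (- t) g)                        ≈⟨ +ₚ-cong (*ₚ-∷ g t q) ≋-refl ⟩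
      (scale t g +ₚ (0# ∷ (g *ₚ q))) +ₚ (s +ₚ scale (- t) g)        ≈⟨ PolySolver.solve 4 (λ x y z w → (x :+ y) :+ (z :+ w) := (y :+ z) :+ (x :+ w)) ≋-refl (scale t g) _ s _ ⟩
      ((0# ∷ (g *ₚ q)) +ₚ s) +ₚ (scale t g +ₚ scale (- t) g)        ≈⟨ +ₚ-cong (≋-refl {(0# ∷ (g *ₚ q)) +ₚ s}) tg-tg≋0 ⟩
      ((0# ∷ (g *ₚ q)) +ₚ s) +ₚ []                                  ≈⟨ +ₚ-identityʳ ((0# ∷ (g *ₚ q)) +ₚ s) ⟩
      (0# + a) ∷ ((g *ₚ q) +ₚ r)                                    ≈⟨ ∷-cong (+-identityˡ a) gq+r≋f ⟩
      a ∷ f                                                         ∎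
      where
      open ≋-Reasoning
      open PolySolver using (_:+_; _:=_)
    below : DegreeBelow (s +ₚ scale (- t) g) e
    below i e≤i = trans (coeff-+ₚ s (scale (- t) g) i) (trans (cong (coeff s i +_) (coeff-scale (- t) g i)) (step i e≤i))
      where
      open ≡-Reasoning
      s-above : ∀ i → e < i → coeff s i ≡ 0#
      s-above (suc i) (s≤s e≤i) = r<e i e≤i
      step : ∀ i → e ≤ i → coeff s i + (- t) · coeff g i ≡ 0#
      step i e≤i with ℕ.m≤n⇒m<n∨m≡n e≤i
      ... | inj₁ e<i = trans (cong₂ _+_ (s-above i e<i) (trans (cong (- t ·_) (degreeAtMost g° i e<i)) (zeroʳ _)))
                             (+-identityʳ 0#)
      ... | inj₂ refl = begin
        coeff s e + (- t) · coeff g e     ≡⟨ cong (coeff s e +_) (sym (-‿distribˡ-* t (coeff g e))) ⟩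
        coeff s e + - (t · coeff g e)     ≡⟨ cong (λ x → coeff s e + - x) (trans (*-assoc _ lc⁻¹ _)
                                               (trans (cong (coeff s e ·_) (trans (*-comm lc⁻¹ _) lc·lc⁻¹≡1)) (*-identityʳ _))) ⟩
        coeff s e + - coeff s e           ≡⟨ -‿inverseʳ _ ⟩
        0#                                ∎

  record Bezout (a b : Poly) : Set where
    constructor bezout
    field
      common : Poly
      coefˡ  : Poly
      coefʳ  : Poly
      common∣ˡ : common ∣ a
      common∣ʳ : common ∣ b
      identity : common ≋ ((a *ₚ coefˡ) +ₚ (b *ₚ coefʳ))

  -- Euclid's algorithm; N bounds the degree of b, which drops at every step.
  bezout-below : ∀ N a b → DegreeBelow b N → Bezout a b
  bezout-below N a b b<N with zero⊎degree b
  ... | inj₁ b≋0 = bezout a 1ₚ [] (∣-refl a) (divides [] (≋-trans (*ₚ-zeroʳ a) (≋-sym b≋0)))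
                     (≋-sym (≋-trans (+ₚ-cong (*ₚ-identityʳ a) (*ₚ-zeroʳ b)) (+ₚ-identityʳ a)))
  bezout-below zero a b b<N | inj₂ (e , b°) = ⊥-elim (leading≢0 b° (b<N e z≤n))
  bezout-below (suc N) a b b<N | inj₂ (e , b°) with divide b° a
  ... | division q r bq+r≋a r<e with bezout-below N b r (λ i N≤i → r<e i (ℕ.≤-trans e≤N N≤i))
    where
    e≤N : e ≤ N
    e≤N = ℕ.≤-pred (ℕ.≰⇒> (λ N<e → leading≢0 b° (b<N e N<e)))
  ... | bezout d u v d∣b d∣r d≋bu+rv = bezout d v (u +ₚ (-1ₚ *ₚ (q *ₚ v)))
          (∣-respʳ-≋ bq+r≋a (∣-+ₚ (∣-*ₚʳ q d∣b) d∣r)) d∣b identity′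
    where
    open ≋-Reasoning
    open PolySolver using (_:+_; _:*_; _:=_)
    r≋a-bq : r ≋ (a +ₚ (-1ₚ *ₚ (b *ₚ q)))
    r≋a-bq = begin
      r                                          ≈⟨ +ₚ-identityʳ r ⟨
      r +ₚ []                                    ≈⟨ +ₚ-cong ≋-refl (+ₚ-inverseʳ (b *ₚ q)) ⟨
      r +ₚ ((b *ₚ q) +ₚ (-1ₚ *ₚ (b *ₚ q)))       ≈⟨ PolySolver.solve 3 (λ x r y → r :+ (x :+ y) := (x :+ r) :+ y) ≋-refl (b *ₚ q) r _ ⟩
      ((b *ₚ q) +ₚ r) +ₚ (-1ₚ *ₚ (b *ₚ q))       ≈⟨ +ₚ-cong bq+r≋a ≋-refl ⟩
      a +ₚ (-1ₚ *ₚ (b *ₚ q))                     ∎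
    identity′ : d ≋ ((a *ₚ v) +ₚ (b *ₚ (u +ₚ (-1ₚ *ₚ (q *ₚ v)))))
    identity′ = begin
      d                                                 ≈⟨ d≋bu+rv ⟩
      (b *ₚ u) +ₚ (r *ₚ v)                              ≈⟨ +ₚ-cong ≋-refl (*ₚ-congˡ v r≋a-bq) ⟩
      (b *ₚ u) +ₚ ((a +ₚ (-1ₚ *ₚ (b *ₚ q))) *ₚ v)       ≈⟨ PolySolver.solve 6 (λ a b q u v m → (b :* u) :+ ((a :+ (m :* (b :* q))) :* v) := (a :* v) :+ (b :* (u :+ (m :* (q :* v))))) ≋-refl a b q u v -1ₚ ⟩
      (a *ₚ v) +ₚ (b *ₚ (u +ₚ (-1ₚ *ₚ (q *ₚ v))))       ∎

  bezoutIdentity : ∀ a b → Bezout a b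
  bezoutIdentity a b = bezout-below (length b) a b (degreeBelow-length b)

  -- The reciprocal

  coeff-applyUpTo-< : ∀ m (k : ℕ → F) i → i < m → coeff (applyUpTo k m) i ≡ k i
  coeff-applyUpTo-< (suc m) k zero    _         = refl
  coeff-applyUpTo-< (suc m) k (suc i) (s≤s i<m) = coeff-applyUpTo-< m (k ∘ suc) i i<m

  coeff-applyUpTo-≥ : ∀ m (k : ℕ → F) i → m ≤ i → coeff (applyUpTo k m) i ≡ 0#
  coeff-applyUpTo-≥ zero    k i       _         = refl
  coeff-applyUpTo-≥ (suc m) k (suc i) (s≤s m≤i) = coeff-applyUpTo-≥ m (k ∘ suc) i m≤i

  coeff-reciprocal-≤ : ∀ n f i → i ≤ n → coeff (reciprocal n f) i ≡ coeff f (n ∸ i)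
  coeff-reciprocal-≤ n f i i≤n = trans (cong (λ l → coeff l i) (List.map-applyUpTo id (λ i → coeff f (n ∸ i)) (suc n)))
                                       (coeff-applyUpTo-< (suc n) (λ i → coeff f (n ∸ i)) i (s≤s i≤n))

  reciprocal-degreeAtMost : ∀ n f → DegreeAtMost (reciprocal n f) n
  reciprocal-degreeAtMost n f i n<i = trans (cong (λ l → coeff l i) (List.map-applyUpTo id (λ i → coeff f (n ∸ i)) (suc n)))
                                            (coeff-applyUpTo-≥ (suc n) (λ i → coeff f (n ∸ i)) i n<i)

  ≋-degreeAtMost : ∀ n {p r} → DegreeAtMost p n → DegreeAtMost r n → (∀ i → i ≤ n → coeff p i ≡ coeff r i) → p ≋ r
  ≋-degreeAtMost n p≤n r≤n low =
    mk≋ λ i → [ low i , (λ n<i → trans (p≤n i n<i) (sym (r≤n i n<i))) ]′ (ℕ.≤-<-connex i n)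

  reciprocal-cong : ∀ n {f g} → f ≋ g → reciprocal n f ≋ reciprocal n g
  reciprocal-cong n {f} {g} f≋g = ≋-degreeAtMost n (reciprocal-degreeAtMost n f) (reciprocal-degreeAtMost n g) λ i i≤n →
    trans (coeff-reciprocal-≤ n f i i≤n) (trans (coeff-≡ f≋g (n ∸ i)) (sym (coeff-reciprocal-≤ n g i i≤n)))

  reciprocal-+ₚ : ∀ n f g → reciprocal n (f +ₚ g) ≋ (reciprocal n f +ₚ reciprocal n g)
  reciprocal-+ₚ n f g = ≋-degreeAtMost n (reciprocal-degreeAtMost n (f +ₚ g)) sum≤n λ i i≤n →
    trans (coeff-reciprocal-≤ n (f +ₚ g) i i≤n) (trans (coeff-+ₚ f g (n ∸ i))
      (trans (cong₂ _+_ (sym (coeff-reciprocal-≤ n f i i≤n)) (sym (coeff-reciprocal-≤ n g i i≤n)))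
             (sym (coeff-+ₚ (reciprocal n f) (reciprocal n g) i))))
    where
    sum≤n : DegreeAtMost (reciprocal n f +ₚ reciprocal n g) n
    sum≤n i n<i = trans (coeff-+ₚ (reciprocal n f) (reciprocal n g) i)
      (trans (cong₂ _+_ (reciprocal-degreeAtMost n f i n<i) (reciprocal-degreeAtMost n g i n<i)) (+-identityʳ 0#))

  reciprocal-scale : ∀ n a f → reciprocal n (scale a f) ≋ scale a (reciprocal n f)
  reciprocal-scale n a f = ≋-degreeAtMost n (reciprocal-degreeAtMost n (scale a f)) scaled≤n λ i i≤n →
    trans (coeff-reciprocal-≤ n (scale a f) i i≤n) (trans (coeff-scale a f (n ∸ i))
      (trans (cong (a ·_) (sym (coeff-reciprocal-≤ n f i i≤n))) (sym (coeff-scale a (reciprocal n f) i))))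
    where
    scaled≤n : DegreeAtMost (scale a (reciprocal n f)) n
    scaled≤n i n<i = trans (coeff-scale a (reciprocal n f) i) (trans (cong (a ·_) (reciprocal-degreeAtMost n f i n<i)) (zeroʳ a))

  reciprocal-0∷ : ∀ n f → reciprocal (suc n) (0# ∷ f) ≋ reciprocal n f
  reciprocal-0∷ n f = ≋-degreeAtMost (suc n) (reciprocal-degreeAtMost (suc n) (0# ∷ f))
    (degreeAtMost-mono (reciprocal n f) (reciprocal-degreeAtMost n f) (ℕ.n≤1+n n)) low
    where
    low : ∀ i → i ≤ suc n → coeff (reciprocal (suc n) (0# ∷ f)) i ≡ coeff (reciprocal n f) i
    low i i≤1+n with ℕ.m≤n⇒m<n∨m≡n i≤1+n
    ... | inj₂ refl = trans (coeff-reciprocal-≤ (suc n) (0# ∷ f) (suc n) i≤1+n)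
                            (trans (cong (coeff (0# ∷ f)) (ℕ.n∸n≡0 (suc n))) (sym (reciprocal-degreeAtMost n f (suc n) (ℕ.n<1+n n))))
    ... | inj₁ (s≤s i≤n) = trans (coeff-reciprocal-≤ (suc n) (0# ∷ f) i i≤1+n)
                                 (trans (cong (coeff (0# ∷ f)) (ℕ.+-∸-assoc 1 i≤n)) (sym (coeff-reciprocal-≤ n f i i≤n)))

  reciprocal-suc : ∀ n g → DegreeAtMost g n → reciprocal (suc n) g ≋ (0# ∷ reciprocal n g)
  reciprocal-suc n g g≤n = mk≋ λ
    { zero    → trans (coeff-reciprocal-≤ (suc n) g 0 z≤n) (g≤n (suc n) (ℕ.n<1+n n))
    ; (suc i) → [ (λ i≤n → trans (coeff-reciprocal-≤ (suc n) g (suc i) (s≤s i≤n)) (sym (coeff-reciprocal-≤ n g i i≤n)))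
                , (λ n<i → trans (reciprocal-degreeAtMost (suc n) g (suc i) (s≤s n<i)) (sym (reciprocal-degreeAtMost n g i n<i)))
                ]′ (ℕ.≤-<-connex i n) }

  reciprocal-involutive : ∀ n f → DegreeAtMost f n → reciprocal n (reciprocal n f) ≋ f
  reciprocal-involutive n f f≤n = ≋-degreeAtMost n (reciprocal-degreeAtMost n (reciprocal n f)) f≤n λ i i≤n →
    trans (coeff-reciprocal-≤ n (reciprocal n f) i i≤n)
          (trans (coeff-reciprocal-≤ n f (n ∸ i) (ℕ.m∸n≤m n i)) (cong (coeff f) (ℕ.m∸[m∸n]≡n i≤n)))

  reciprocal-degree : ∀ n f → coeff f 0 ≢ 0# → IsDegree (reciprocal n f) n
  reciprocal-degree n f f₀≢0 = isDegree (λ top≡0 → f₀≢0 (trans (sym top≡f₀) top≡0)) (reciprocal-degreeAtMost n f)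
    where
    top≡f₀ : coeff (reciprocal n f) n ≡ coeff f 0
    top≡f₀ = trans (coeff-reciprocal-≤ n f n ℕ.≤-refl) (cong (coeff f) (ℕ.n∸n≡0 n))

  ≋-constant+0∷divX : ∀ f → f ≋ (constant (coeff f 0) +ₚ (0# ∷ divX f))
  ≋-constant+0∷divX f = mk≋ λ { zero → sym (+-identityʳ _) ; (suc i) → coeff-suc f i }

  constant≋scale-1ₚ : ∀ c → constant c ≋ scale c 1ₚ
  constant≋scale-1ₚ c = ∷-cong (sym (*-identityʳ c)) ≋-refl

  1ₚ-degreeAtMost : ∀ k → DegreeAtMost 1ₚ k
  1ₚ-degreeAtMost k (suc i) _ = refl

  -- reciprocal k 1ₚ is the monomial x^k.
  reciprocal-+-shift : ∀ k n g → DegreeAtMost g n → reciprocal (k ℕ.+ n) g ≋ (reciprocal k 1ₚ *ₚ reciprocal n g)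
  reciprocal-+-shift zero    n g g≤n = ≋-sym (*ₚ-identityˡ (reciprocal n g))
  reciprocal-+-shift (suc k) n g g≤n = begin
    reciprocal (suc (k ℕ.+ n)) g               ≈⟨ reciprocal-suc (k ℕ.+ n) g (degreeAtMost-mono g g≤n (ℕ.m≤n+m n k)) ⟩
    0# ∷ reciprocal (k ℕ.+ n) g                ≈⟨ ∷-cong refl (reciprocal-+-shift k n g g≤n) ⟩
    0# ∷ (reciprocal k 1ₚ *ₚ reciprocal n g)   ≈⟨ 0∷-*ₚ (reciprocal k 1ₚ) (reciprocal n g) ⟨
    (0# ∷ reciprocal k 1ₚ) *ₚ reciprocal n g   ≈⟨ *ₚ-congˡ (reciprocal n g) (reciprocal-suc k 1ₚ (1ₚ-degreeAtMost k)) ⟨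
    reciprocal (suc k) 1ₚ *ₚ reciprocal n g    ∎
    where open ≋-Reasoning

  reciprocal-constant+0∷ : ∀ m c f → reciprocal (suc m) (constant c +ₚ (0# ∷ f)) ≋ (scale c (reciprocal (suc m) 1ₚ) +ₚ reciprocal m f)
  reciprocal-constant+0∷ m c f = ≋-trans (reciprocal-+ₚ (suc m) (constant c) (0# ∷ f))
    (+ₚ-cong (≋-trans (reciprocal-cong (suc m) (constant≋scale-1ₚ c)) (reciprocal-scale (suc m) c 1ₚ)) (reciprocal-0∷ m f))

  reciprocal-*ₚ : ∀ m n f g → DegreeAtMost f m → DegreeAtMost g n →
                  reciprocal (m ℕ.+ n) (f *ₚ g) ≋ (reciprocal m f *ₚ reciprocal n g)
  reciprocal-*ₚ zero n f g f≤0 g≤n = begin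
    reciprocal n (f *ₚ g)                     ≈⟨ reciprocal-cong n (≋-trans (*ₚ-congˡ g (degreeAtMost-zero f f≤0)) (constant-*ₚ c g)) ⟩
    reciprocal n (scale c g)                  ≈⟨ reciprocal-scale n c g ⟩
    scale c (reciprocal n g)                  ≈⟨ constant-*ₚ c (reciprocal n g) ⟨
    constant c *ₚ reciprocal n g              ∎
    where
    open ≋-Reasoning
    c = coeff f 0
  reciprocal-*ₚ (suc m) n f g f≤m g≤n = begin
    reciprocal (suc m ℕ.+ n) (f *ₚ g)
      ≈⟨ reciprocal-cong (suc (m ℕ.+ n)) (*ₚ-congˡ g (≋-constant+0∷divX f)) ⟩
    reciprocal (suc m ℕ.+ n) ((constant c +ₚ (0# ∷ divX f)) *ₚ g)
      ≈⟨ reciprocal-cong (suc (m ℕ.+ n)) (≋-trans (*ₚ-distribʳ (constant c) (0# ∷ divX f) g) (+ₚ-cong (constant-*ₚ c g) (0∷-*ₚ (divX f) g))) ⟩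
    reciprocal (suc m ℕ.+ n) (scale c g +ₚ (0# ∷ (divX f *ₚ g)))
      ≈⟨ reciprocal-+ₚ (suc (m ℕ.+ n)) (scale c g) _ ⟩
    reciprocal (suc m ℕ.+ n) (scale c g) +ₚ reciprocal (suc m ℕ.+ n) (0# ∷ (divX f *ₚ g))
      ≈⟨ +ₚ-cong (reciprocal-scale (suc (m ℕ.+ n)) c g) (reciprocal-0∷ (m ℕ.+ n) (divX f *ₚ g)) ⟩
    scale c (reciprocal (suc m ℕ.+ n) g) +ₚ reciprocal (m ℕ.+ n) (divX f *ₚ g)
      ≈⟨ +ₚ-cong (scale-cong refl (reciprocal-+-shift (suc m) n g g≤n)) (reciprocal-*ₚ m n (divX f) g (divX-degreeAtMost f f≤m) g≤n) ⟩
    scale c (reciprocal (suc m) 1ₚ *ₚ reciprocal n g) +ₚ (reciprocal m (divX f) *ₚ reciprocal n g)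
      ≈⟨ +ₚ-cong (scale-*ₚ c (reciprocal (suc m) 1ₚ) (reciprocal n g)) (≋-refl {reciprocal m (divX f) *ₚ reciprocal n g}) ⟨
    (scale c (reciprocal (suc m) 1ₚ) *ₚ reciprocal n g) +ₚ (reciprocal m (divX f) *ₚ reciprocal n g)
      ≈⟨ *ₚ-distribʳ (scale c (reciprocal (suc m) 1ₚ)) (reciprocal m (divX f)) (reciprocal n g) ⟨
    (scale c (reciprocal (suc m) 1ₚ) +ₚ reciprocal m (divX f)) *ₚ reciprocal n g
      ≈⟨ *ₚ-congˡ (reciprocal n g) (≋-trans (reciprocal-cong (suc m) (≋-constant+0∷divX f)) (reciprocal-constant+0∷ m c (divX f))) ⟨
    reciprocal (suc m) f *ₚ reciprocal n g
      ∎
    where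
    open ≋-Reasoning
    c = coeff f 0

  -- Evaluation at 1

  eval₁ : Poly → F
  eval₁ []      = 0#
  eval₁ (a ∷ p) = a + eval₁ p

  eval₁-≋[] : ∀ p → p ≋ [] → eval₁ p ≡ 0#
  eval₁-≋[] []      _    = refl
  eval₁-≋[] (a ∷ p) p≋0 = trans (cong₂ _+_ (coeff-≡ p≋0 0) (eval₁-≋[] p (divX-cong p≋0))) (+-identityʳ 0#)

  eval₁-cong : ∀ {p r} → p ≋ r → eval₁ p ≡ eval₁ r
  eval₁-cong {[]}    {r}     p≋r = sym (eval₁-≋[] r (≋-sym p≋r))
  eval₁-cong {a ∷ p} {[]}    p≋r = eval₁-≋[] (a ∷ p) p≋r
  eval₁-cong {a ∷ p} {b ∷ r} p≋r = cong₂ _+_ (coeff-≡ p≋r 0) (eval₁-cong {p} {r} (divX-cong p≋r))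

  eval₁-+ₚ : ∀ p r → eval₁ (p +ₚ r) ≡ eval₁ p + eval₁ r
  eval₁-+ₚ []      r       = sym (+-identityˡ _)
  eval₁-+ₚ (a ∷ p) []      = sym (+-identityʳ _)
  eval₁-+ₚ (a ∷ p) (b ∷ r) = trans (cong ((a + b) +_) (eval₁-+ₚ p r))
    (interchange a b (eval₁ p) (eval₁ r))

  eval₁-scale : ∀ c p → eval₁ (scale c p) ≡ c · eval₁ p
  eval₁-scale c []      = sym (zeroʳ c)
  eval₁-scale c (a ∷ p) = trans (cong (c · a +_) (eval₁-scale c p)) (sym (distribˡ c a (eval₁ p)))

  eval₁-*ₚ : ∀ p r → eval₁ (p *ₚ r) ≡ eval₁ p · eval₁ r
  eval₁-*ₚ []      r = sym (zeroˡ _)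
  eval₁-*ₚ (a ∷ p) r = trans (eval₁-+ₚ (scale a r) (0# ∷ (p *ₚ r)))
    (trans (cong₂ _+_ (eval₁-scale a r) (trans (+-identityˡ _) (eval₁-*ₚ p r))) (sym (distribʳ (eval₁ r) a (eval₁ p))))

  eval₁-reciprocal-1ₚ : ∀ k → eval₁ (reciprocal k 1ₚ) ≡ 1#
  eval₁-reciprocal-1ₚ zero    = +-identityʳ 1#
  eval₁-reciprocal-1ₚ (suc k) = trans (eval₁-cong (reciprocal-suc k 1ₚ (1ₚ-degreeAtMost k)))
                                      (trans (+-identityˡ _) (eval₁-reciprocal-1ₚ k))

  eval₁-reciprocal : ∀ n f → DegreeAtMost f n → eval₁ (reciprocal n f) ≡ eval₁ f
  eval₁-reciprocal n       []      _   = eval₁-≋[] (reciprocal n []) (≋-degreeAtMost n (reciprocal-degreeAtMost n []) (λ _ _ → refl) (coeff-reciprocal-≤ n []))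
  eval₁-reciprocal zero    (a ∷ f) f≤0 = cong (a +_) (sym (eval₁-≋[] f (mk≋ λ i → f≤0 (suc i) (s≤s z≤n))))
  eval₁-reciprocal (suc n) (a ∷ f) f≤n = begin
    eval₁ (reciprocal (suc n) (a ∷ f))                            ≡⟨ eval₁-cong (reciprocal-cong (suc n) (≋-constant+0∷divX (a ∷ f))) ⟩
    eval₁ (reciprocal (suc n) (constant a +ₚ (0# ∷ f)))           ≡⟨ eval₁-cong (reciprocal-constant+0∷ n a f) ⟩
    eval₁ (scale a (reciprocal (suc n) 1ₚ) +ₚ reciprocal n f)     ≡⟨ eval₁-+ₚ (scale a (reciprocal (suc n) 1ₚ)) (reciprocal n f) ⟩
    eval₁ (scale a (reciprocal (suc n) 1ₚ)) + eval₁ (reciprocal n f)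
      ≡⟨ cong₂ _+_ (trans (eval₁-scale a (reciprocal (suc n) 1ₚ)) (trans (cong (a ·_) (eval₁-reciprocal-1ₚ (suc n))) (*-identityʳ a)))
                   (eval₁-reciprocal n f (divX-degreeAtMost (a ∷ f) f≤n)) ⟩
    a + eval₁ f                                                   ∎
    where open ≡-Reasoning

  -- Self-reciprocal polynomials

  record IsSelfReciprocal (f : Poly) (n : ℕ) : Set where
    constructor isSelfReciprocal
    field
      const≢0 : coeff f 0 ≢ 0#
      degree  : IsDegree f n
      fixed   : f ≋ reciprocal n f
  open IsSelfReciprocal public

  toSelfReciprocal : ∀ {f n} → IsSelfReciprocal f n → SelfReciprocal f
  toSelfReciprocal {n = n} (isSelfReciprocal f₀≢0 f° f≋f*) = f₀≢0 , n , toHasDegree f° , coeff-≡ f≋f*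

  fromSelfReciprocal : ∀ {f d} → SelfReciprocal f → IsDegree f d → IsSelfReciprocal f d
  fromSelfReciprocal {f} (f₀≢0 , n , f°ₙ , f≈f*) f° with degree-unique (fromHasDegree f f°ₙ) f°
  ... | refl = isSelfReciprocal f₀≢0 f° (mk≋ f≈f*)

  IsSelfReciprocal-resp-≋ : ∀ {p r n} → p ≋ r → IsSelfReciprocal p n → IsSelfReciprocal r n
  IsSelfReciprocal-resp-≋ {n = n} p≋r (isSelfReciprocal p₀≢0 p° p≋p*) =
    isSelfReciprocal (λ r₀≡0 → p₀≢0 (trans (coeff-≡ p≋r 0) r₀≡0)) (IsDegree-resp-≋ p≋r p°)
                     (≋-trans (≋-sym p≋r) (≋-trans p≋p* (reciprocal-cong n p≋r)))

  *ₚ-selfReciprocal : ∀ {a b m n} → IsSelfReciprocal a m → IsSelfReciprocal b n → IsSelfReciprocal (a *ₚ b) (m ℕ.+ n)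
  *ₚ-selfReciprocal {a} {b} {m} {n} (isSelfReciprocal a₀≢0 a° a≋a*) (isSelfReciprocal b₀≢0 b° b≋b*) =
    isSelfReciprocal (λ ab₀≡0 → ·-nonZero a₀≢0 b₀≢0 (trans (sym (coeff-*ₚ-zero a b)) ab₀≡0)) (*ₚ-degree a° b°)
      (≋-trans (*ₚ-cong a≋a* b≋b*) (≋-sym (reciprocal-*ₚ m n a b (degreeAtMost a°) (degreeAtMost b°))))

  scale-selfReciprocal : ∀ {a n} c → c ≢ 0# → IsSelfReciprocal a n → IsSelfReciprocal (scale c a) n
  scale-selfReciprocal {a} {n} c c≢0 (isSelfReciprocal a₀≢0 a° a≋a*) =
    isSelfReciprocal (λ ca₀≡0 → ·-nonZero c≢0 a₀≢0 (trans (sym (coeff-scale c a 0)) ca₀≡0))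
      (isDegree (λ caₙ≡0 → ·-nonZero c≢0 (leading≢0 a°) (trans (sym (coeff-scale c a n)) caₙ≡0))
                (λ i n<i → trans (coeff-scale c a i) (trans (cong (c ·_) (degreeAtMost a° i n<i)) (zeroʳ c))))
      (≋-trans (scale-cong refl a≋a*) (≋-sym (reciprocal-scale n c a)))

  SelfReciprocalFree : Poly → Set
  SelfReciprocalFree h = ∀ d → SRFactorOfDegree h d → d ≡ 0

  factors-const≢0 : ∀ {f} a b → (a *ₚ b) ≋ f → coeff f 0 ≢ 0# → (coeff a 0 ≢ 0#) × (coeff b 0 ≢ 0#)
  factors-const≢0 a b ab≋f f₀≢0 =
      (λ a₀≡0 → f₀≢0 (trans (sym (coeff-≡ ab≋f 0)) (trans (coeff-*ₚ-zero a b) (trans (cong (_· coeff b 0) a₀≡0) (zeroˡ _)))))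
    , (λ b₀≡0 → f₀≢0 (trans (sym (coeff-≡ ab≋f 0)) (trans (coeff-*ₚ-zero a b) (trans (cong (coeff a 0 ·_) b₀≡0) (zeroʳ _)))))

  record FactorDegrees (a b : Poly) (n : ℕ) : Set where
    constructor factorDegrees
    field
      degreeˡ  : ℕ
      degreeʳ  : ℕ
      isDegreeˡ : IsDegree a degreeˡ
      isDegreeʳ : IsDegree b degreeʳ
      sum      : n ≡ degreeˡ ℕ.+ degreeʳ

  factor-degrees : ∀ {f n} a b → IsDegree f n → (a *ₚ b) ≋ f → FactorDegrees a b n
  factor-degrees a b f° ab≋f with zero⊎degree a | zero⊎degree b
  ... | inj₁ a≋0 | _ = ⊥-elim (degree⇒≉0 f° (≋-trans (≋-sym ab≋f) (*ₚ-congˡ b a≋0)))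
  ... | inj₂ _ | inj₁ b≋0 = ⊥-elim (degree⇒≉0 f° (≋-trans (≋-sym ab≋f) (≋-trans (*ₚ-congʳ a b≋0) (*ₚ-zeroʳ a))))
  ... | inj₂ (m , a°) | inj₂ (n , b°) = factorDegrees m n a° b° (degree-unique f° (IsDegree-resp-≋ ab≋f (*ₚ-degree a° b°)))

  cofactor-degree-zero : ∀ {f n} a b → IsDegree f n → IsDegree a n → (a *ₚ b) ≋ f → IsDegree b 0
  cofactor-degree-zero {n = n} a b f° a° ab≋f with factor-degrees a b f° ab≋f
  ... | factorDegrees m k a°ₘ b° n≡m+k with degree-unique a° a°ₘ
  ... | refl = subst (IsDegree b) (ℕ.+-cancelˡ-≡ n k 0 (trans (sym n≡m+k) (sym (ℕ.+-identityʳ n)))) b°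

  *ₚ-≋[] : ∀ {a d} x → IsDegree a d → (a *ₚ x) ≋ [] → x ≋ []
  *ₚ-≋[] x a° ax≋0 with zero⊎degree x
  ... | inj₁ x≋0 = x≋0
  ... | inj₂ (_ , x°) = ⊥-elim (degree⇒≉0 (*ₚ-degree a° x°) ax≋0)

  *ₚ-cancelˡ : ∀ {a d} x y → IsDegree a d → (a *ₚ x) ≋ (a *ₚ y) → x ≋ y
  *ₚ-cancelˡ {a} x y a° ax≋ay = begin
    x                                 ≈⟨ +ₚ-identityʳ x ⟨
    x +ₚ []                           ≈⟨ +ₚ-cong ≋-refl (+ₚ-inverseʳ y) ⟨
    x +ₚ (y +ₚ (-1ₚ *ₚ y))            ≈⟨ PolySolver.solve 3 (λ x y m → x :+ (y :+ (m :* y)) := (x :+ (m :* y)) :+ y) ≋-refl x y -1ₚ ⟩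
    (x +ₚ (-1ₚ *ₚ y)) +ₚ y            ≈⟨ +ₚ-cong (*ₚ-≋[] (x +ₚ (-1ₚ *ₚ y)) a° a[x-y]≋0) ≋-refl ⟩
    y                                 ∎
    where
    open ≋-Reasoning
    open PolySolver using (_:+_; _:*_; _:=_)
    a[x-y]≋0 : (a *ₚ (x +ₚ (-1ₚ *ₚ y))) ≋ []
    a[x-y]≋0 = begin
      a *ₚ (x +ₚ (-1ₚ *ₚ y))          ≈⟨ PolySolver.solve 4 (λ a x y m → a :* (x :+ (m :* y)) := (a :* x) :+ (m :* (a :* y))) ≋-refl a x y -1ₚ ⟩
      (a *ₚ x) +ₚ (-1ₚ *ₚ (a *ₚ y))   ≈⟨ +ₚ-cong ax≋ay ≋-refl ⟩
      (a *ₚ y) +ₚ (-1ₚ *ₚ (a *ₚ y))   ≈⟨ +ₚ-inverseʳ (a *ₚ y) ⟩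
      []                              ∎

  ∣-respˡ-≋ : ∀ {g g′ f} → g ≋ g′ → g ∣ f → g′ ∣ f
  ∣-respˡ-≋ g≋g′ (divides h gh≋f) = divides h (≋-trans (*ₚ-congˡ h (≋-sym g≋g′)) gh≋f)

  *ₚ-monoˡ-∣ : ∀ {a b} c → a ∣ b → (c *ₚ a) ∣ (c *ₚ b)
  *ₚ-monoˡ-∣ {a} c (divides h ah≋b) = divides h (≋-trans (*ₚ-assoc c a h) (*ₚ-congʳ c ah≋b))

  constant-∣ : ∀ {u} f → IsDegree u 0 → u ∣ f
  constant-∣ {u} f u° with inverse (coeff u 0) (leading≢0 u°)
  ... | u₀⁻¹ , u₀u₀⁻¹≡1 = divides (scale u₀⁻¹ f) (begin
    u *ₚ scale u₀⁻¹ f                     ≈⟨ *ₚ-congˡ (scale u₀⁻¹ f) (degree-zero u°) ⟩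
    constant (coeff u 0) *ₚ scale u₀⁻¹ f  ≈⟨ constant-*ₚ (coeff u 0) (scale u₀⁻¹ f) ⟩
    scale (coeff u 0) (scale u₀⁻¹ f)      ≈⟨ scale-scale (coeff u 0) u₀⁻¹ f ⟩
    scale (coeff u 0 · u₀⁻¹) f            ≈⟨ scale-cong u₀u₀⁻¹≡1 ≋-refl ⟩
    scale 1# f                            ≈⟨ scale-one f ⟩
    f                                     ∎)
    where open ≋-Reasoning

  coprime-∣ : ∀ {a b u v h z} → 1ₚ ≋ ((a *ₚ u) +ₚ (b *ₚ v)) → (a *ₚ z) ≋ (h *ₚ b) → a ∣ h
  coprime-∣ {a} {b} {u} {v} {h} {z} 1≋au+bv az≋hb = divides ((h *ₚ u) +ₚ (z *ₚ v)) (≋-sym (begin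
    h                                      ≈⟨ *ₚ-identityʳ h ⟨
    h *ₚ 1ₚ                                ≈⟨ *ₚ-congʳ h 1≋au+bv ⟩
    h *ₚ ((a *ₚ u) +ₚ (b *ₚ v))            ≈⟨ PolySolver.solve 5 (λ h a b u v → h :* ((a :* u) :+ (b :* v)) := (a :* (h :* u)) :+ ((h :* b) :* v)) ≋-refl h a b u v ⟩
    (a *ₚ (h *ₚ u)) +ₚ ((h *ₚ b) *ₚ v)     ≈⟨ +ₚ-cong ≋-refl (*ₚ-congˡ v az≋hb) ⟨
    (a *ₚ (h *ₚ u)) +ₚ ((a *ₚ z) *ₚ v)     ≈⟨ PolySolver.solve 4 (λ a x z v → (a :* x) :+ ((a :* z) :* v) := a :* (x :+ (z :* v))) ≋-refl a (h *ₚ u) z v ⟩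
    a *ₚ ((h *ₚ u) +ₚ (z *ₚ v))            ∎))
    where
    open ≋-Reasoning
    open PolySolver using (_:+_; _:*_; _:=_)

  record CoprimeFactorization (a b : Poly) (m n : ℕ) : Set where
    field
      common    : Poly
      cofactorˡ : Poly
      cofactorʳ : Poly
      coefˡ     : Poly
      coefʳ     : Poly
      δ κ γ     : ℕ
      common-degree    : IsDegree common δ
      cofactorˡ-degree : IsDegree cofactorˡ κ
      cofactorʳ-degree : IsDegree cofactorʳ γ
      m≡δ+κ : m ≡ δ ℕ.+ κ
      n≡δ+γ : n ≡ δ ℕ.+ γ
      factorˡ : (common *ₚ cofactorˡ) ≋ a
      factorʳ : (common *ₚ cofactorʳ) ≋ b
      coprime : 1ₚ ≋ ((cofactorˡ *ₚ coefˡ) +ₚ (cofactorʳ *ₚ coefʳ))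

  -- Divide a and b by the combination d = a u + b v of Bézout's identity.
  coprimeFactorization : ∀ {a b m n} → IsDegree a m → IsDegree b n → CoprimeFactorization a b m n
  coprimeFactorization {a} {b} a° b° with bezoutIdentity a b
  ... | bezout d u v (divides a′ da′≋a) (divides b′ db′≋b) d≋au+bv
    with factor-degrees d a′ a° da′≋a | factor-degrees d b′ b° db′≋b
  ... | factorDegrees δ κ d° a′° m≡δ+κ | factorDegrees δ′ γ d°′ b′° n≡δ′+γ
    with degree-unique d° d°′
  ... | refl = record
    { common = d ; cofactorˡ = a′ ; cofactorʳ = b′ ; coefˡ = u ; coefʳ = v
    ; common-degree = d° ; cofactorˡ-degree = a′° ; cofactorʳ-degree = b′°
    ; m≡δ+κ = m≡δ+κ ; n≡δ+γ = n≡δ′+γ ; factorˡ = da′≋a ; factorʳ = db′≋b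
    ; coprime = *ₚ-cancelˡ 1ₚ _ d° (begin
        d *ₚ 1ₚ                                  ≈⟨ *ₚ-identityʳ d ⟩
        d                                        ≈⟨ d≋au+bv ⟩
        (a *ₚ u) +ₚ (b *ₚ v)                     ≈⟨ +ₚ-cong (*ₚ-congˡ u da′≋a) (*ₚ-congˡ v db′≋b) ⟨
        ((d *ₚ a′) *ₚ u) +ₚ ((d *ₚ b′) *ₚ v)     ≈⟨ PolySolver.solve 5 (λ d a b u v → ((d :* a) :* u) :+ ((d :* b) :* v) := d :* ((a :* u) :+ (b :* v))) ≋-refl d a′ b′ u v ⟩
        d *ₚ ((a′ *ₚ u) +ₚ (b′ *ₚ v))            ∎) }
    where
    open ≋-Reasoning
    open PolySolver using (_:+_; _:*_; _:=_)

  selfReciprocal-factor : ∀ {a m d a′ δ κ} → IsSelfReciprocal a m → IsDegree d δ → IsDegree a′ κ → m ≡ δ ℕ.+ κ →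
                          (d *ₚ a′) ≋ a → a ≋ (reciprocal δ d *ₚ reciprocal κ a′)
  selfReciprocal-factor {a} {d = d} {a′} {δ} {κ} a* d° a′° refl da′≋a = begin
    a                                   ≈⟨ fixed a* ⟩
    reciprocal (δ ℕ.+ κ) a              ≈⟨ reciprocal-cong (δ ℕ.+ κ) da′≋a ⟨
    reciprocal (δ ℕ.+ κ) (d *ₚ a′)      ≈⟨ reciprocal-*ₚ δ κ d a′ (degreeAtMost d°) (degreeAtMost a′°) ⟩
    reciprocal δ d *ₚ reciprocal κ a′   ∎
    where open ≋-Reasoning

  reciprocal≋scale⇒c·c≡1 : ∀ {p κ} c → IsDegree p κ → reciprocal κ p ≋ scale c p → c · c ≡ 1#
  reciprocal≋scale⇒c·c≡1 {p} {κ} c p° p*≋cp =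
    ·-cancelʳ (c · c) 1# (leading≢0 p°) (sym (trans (*-identityˡ _) (trans (coeff-≡ p≋c²p κ) (coeff-scale (c · c) p κ))))
    where
    open ≋-Reasoning
    p≋c²p : p ≋ scale (c · c) p
    p≋c²p = begin
      p                                   ≈⟨ reciprocal-involutive κ p (degreeAtMost p°) ⟨
      reciprocal κ (reciprocal κ p)       ≈⟨ reciprocal-cong κ p*≋cp ⟩
      reciprocal κ (scale c p)            ≈⟨ reciprocal-scale κ c p ⟩
      scale c (reciprocal κ p)            ≈⟨ scale-cong refl p*≋cp ⟩
      scale c (scale c p)                 ≈⟨ scale-scale c c p ⟩
      scale (c · c) p                     ∎

  cofactor-rescaled : ∀ {a d D a′ K c δ} → IsDegree D δ → d ≋ scale c D →
                      (d *ₚ a′) ≋ a → (D *ₚ K) ≋ a → K ≋ scale c a′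
  cofactor-rescaled {a} {d} {D} {a′} {K} {c} D° d≋cD da′≋a DK≋a = *ₚ-cancelˡ K (scale c a′) D° (begin
    D *ₚ K             ≈⟨ DK≋a ⟩
    a                  ≈⟨ da′≋a ⟨
    d *ₚ a′            ≈⟨ *ₚ-congˡ a′ d≋cD ⟩
    scale c D *ₚ a′    ≈⟨ scale-*ₚ c D a′ ⟩
    scale c (D *ₚ a′)  ≈⟨ *ₚ-scale c D a′ ⟨
    D *ₚ scale c a′    ∎)
    where open ≋-Reasoning

  -- The reciprocal d* of the common factor divides a u + b v = d, so d = c d* for a
  -- constant c, and then both cofactors are carried to c times themselves.
  cofactors-reciprocal : ∀ {a b m n} → IsSelfReciprocal a m → IsSelfReciprocal b n → (cf : CoprimeFactorization a b m n) →
    let open CoprimeFactorization cf in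
    ∃[ c ] (c · c ≡ 1#) × (reciprocal κ cofactorˡ ≋ scale c cofactorˡ) × (reciprocal γ cofactorʳ ≋ scale c cofactorʳ)
  cofactors-reciprocal {a} {b} a* b* cf = c , reciprocal≋scale⇒c·c≡1 c cofactorˡ-degree K≋ca′ , K≋ca′ , G≋cb′
    where
    open CoprimeFactorization cf
    open ≋-Reasoning
    open PolySolver using (_:+_; _:*_; _:=_)
    d = common
    D = reciprocal δ d
    K = reciprocal κ cofactorˡ
    G = reciprocal γ cofactorʳ
    D° : IsDegree D δ
    D° = reciprocal-degree δ d (proj₁ (factors-const≢0 d cofactorˡ factorˡ (const≢0 a*)))
    DK≋a : (D *ₚ K) ≋ a
    DK≋a = ≋-sym (selfReciprocal-factor a* common-degree cofactorˡ-degree m≡δ+κ factorˡ)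
    DG≋b : (D *ₚ G) ≋ b
    DG≋b = ≋-sym (selfReciprocal-factor b* common-degree cofactorʳ-degree n≡δ+γ factorʳ)
    w = (K *ₚ coefˡ) +ₚ (G *ₚ coefʳ)
    Dw≋d : (D *ₚ w) ≋ d
    Dw≋d = begin
      D *ₚ ((K *ₚ coefˡ) +ₚ (G *ₚ coefʳ))                              ≈⟨ PolySolver.solve 5 (λ D K G u v → D :* ((K :* u) :+ (G :* v)) := ((D :* K) :* u) :+ ((D :* G) :* v)) ≋-refl D K G coefˡ coefʳ ⟩
      ((D *ₚ K) *ₚ coefˡ) +ₚ ((D *ₚ G) *ₚ coefʳ)                        ≈⟨ +ₚ-cong (*ₚ-congˡ coefˡ (≋-trans DK≋a (≋-sym factorˡ))) (*ₚ-congˡ coefʳ (≋-trans DG≋b (≋-sym factorʳ))) ⟩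
      ((d *ₚ cofactorˡ) *ₚ coefˡ) +ₚ ((d *ₚ cofactorʳ) *ₚ coefʳ)        ≈⟨ PolySolver.solve 5 (λ d a b u v → ((d :* a) :* u) :+ ((d :* b) :* v) := d :* ((a :* u) :+ (b :* v))) ≋-refl d cofactorˡ cofactorʳ coefˡ coefʳ ⟩
      d *ₚ ((cofactorˡ *ₚ coefˡ) +ₚ (cofactorʳ *ₚ coefʳ))              ≈⟨ *ₚ-congʳ d coprime ⟨
      d *ₚ 1ₚ                                                          ≈⟨ *ₚ-identityʳ d ⟩
      d                                                                ∎
    c = coeff w 0
    d≋cD : d ≋ scale c D
    d≋cD = begin
      d                   ≈⟨ Dw≋d ⟨
      D *ₚ w              ≈⟨ *ₚ-congʳ D (degree-zero (cofactor-degree-zero D w common-degree D° Dw≋d)) ⟩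
      D *ₚ constant c     ≈⟨ *ₚ-comm D (constant c) ⟩
      constant c *ₚ D     ≈⟨ constant-*ₚ c D ⟩
      scale c D           ∎
    K≋ca′ : K ≋ scale c cofactorˡ
    K≋ca′ = cofactor-rescaled D° d≋cD factorˡ DK≋a
    G≋cb′ : G ≋ scale c cofactorʳ
    G≋cb′ = cofactor-rescaled D° d≋cD factorʳ DG≋b

  antiSelfReciprocal⇒eval₁≡0 : ∀ {p κ} → - 1# ≢ 1# → IsDegree p κ → reciprocal κ p ≋ scale (- 1#) p → eval₁ p ≡ 0#
  antiSelfReciprocal⇒eval₁≡0 {p} {κ} -1≢1 p° p*≋-p = x≡-x⇒x≡0 -1≢1 (begin
    eval₁ p                 ≡⟨ eval₁-reciprocal κ p (degreeAtMost p°) ⟨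
    eval₁ (reciprocal κ p)  ≡⟨ eval₁-cong p*≋-p ⟩
    eval₁ (scale (- 1#) p)  ≡⟨ eval₁-scale (- 1#) p ⟩
    - 1# · eval₁ p          ≡⟨ -1*x≈-x (eval₁ p) ⟩
    - eval₁ p               ∎)
    where open ≡-Reasoning

  coprime⇒¬common-root-1 : ∀ {a b u v} → 1ₚ ≋ ((a *ₚ u) +ₚ (b *ₚ v)) → eval₁ a ≡ 0# → eval₁ b ≡ 0# → ⊥
  coprime⇒¬common-root-1 {a} {b} {u} {v} 1≋au+bv a₁≡0 b₁≡0 = 1≢0 (begin
    1#                                   ≡⟨ +-identityʳ 1# ⟨
    eval₁ 1ₚ                             ≡⟨ eval₁-cong 1≋au+bv ⟩
    eval₁ ((a *ₚ u) +ₚ (b *ₚ v))         ≡⟨ eval₁-+ₚ (a *ₚ u) (b *ₚ v) ⟩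
    eval₁ (a *ₚ u) + eval₁ (b *ₚ v)      ≡⟨ cong₂ _+_ (trans (eval₁-*ₚ a u) (trans (cong (_· eval₁ u) a₁≡0) (zeroˡ _)))
                                                      (trans (eval₁-*ₚ b v) (trans (cong (_· eval₁ v) b₁≡0) (zeroˡ _))) ⟩
    0# + 0#                              ≡⟨ +-identityʳ 0# ⟩
    0#                                   ∎)
    where open ≡-Reasoning

  selfReciprocal-∣-*ₚ⇒∣ : ∀ {k g h m n} → IsSelfReciprocal k m → IsSelfReciprocal g n →
                          SelfReciprocalFree h → k ∣ (h *ₚ g) → k ∣ g
  selfReciprocal-∣-*ₚ⇒∣ {k} {g} {h} k* g* h-free (divides z kz≋hg) = bySign (cofactors-reciprocal k* g* cf)
    where
    cf = coprimeFactorization (degree k*) (degree g*)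
    open CoprimeFactorization cf
    open ≋-Reasoning
    open PolySolver using (_:*_; _:=_)
    k′ = cofactorˡ
    g′ = cofactorʳ
    k′∣h : k′ ∣ h
    k′∣h = coprime-∣ coprime (*ₚ-cancelˡ (k′ *ₚ z) (h *ₚ g′) common-degree (begin
      common *ₚ (k′ *ₚ z)      ≈⟨ *ₚ-assoc common k′ z ⟨
      (common *ₚ k′) *ₚ z      ≈⟨ *ₚ-congˡ z factorˡ ⟩
      k *ₚ z                   ≈⟨ kz≋hg ⟩
      h *ₚ g                   ≈⟨ *ₚ-congʳ h factorʳ ⟨
      h *ₚ (common *ₚ g′)      ≈⟨ PolySolver.solve 3 (λ h d g → h :* (d :* g) := d :* (h :* g)) ≋-refl h common g′ ⟩
      common *ₚ (h *ₚ g′)      ∎))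
    k′* : reciprocal κ k′ ≋ k′ → IsSelfReciprocal k′ κ
    k′* k′*≋k′ = isSelfReciprocal (proj₂ (factors-const≢0 common k′ factorˡ (const≢0 k*))) cofactorˡ-degree (≋-sym k′*≋k′)
    bySign : ∃[ c ] (c · c ≡ 1#) × (reciprocal κ k′ ≋ scale c k′) × (reciprocal γ g′ ≋ scale c g′) → k ∣ g
    bySign (c , c·c≡1 , k′*≋ck′ , g′*≋cg′) with c ≟ 1#
    ... | yes refl = ∣-respʳ-≋ factorʳ (∣-respˡ-≋ factorˡ (*ₚ-monoˡ-∣ common (constant-∣ g′ k′°)))
      where
      κ≡0 : κ ≡ 0
      κ≡0 = h-free κ (k′ , toDivides k′∣h , toSelfReciprocal (k′* (≋-trans k′*≋ck′ (scale-one k′))) , toHasDegree cofactorˡ-degree)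
      k′° : IsDegree k′ 0
      k′° = subst (IsDegree k′) κ≡0 cofactorˡ-degree
    ... | no c≢1 with x·x≡1⇒x≡±1 c c·c≡1
    ...   | inj₁ c≡1 = ⊥-elim (c≢1 c≡1)
    ...   | inj₂ refl = ⊥-elim (coprime⇒¬common-root-1 {k′} {g′} {coefˡ} {coefʳ} coprime
                          (antiSelfReciprocal⇒eval₁≡0 c≢1 cofactorˡ-degree k′*≋ck′)
                          (antiSelfReciprocal⇒eval₁≡0 c≢1 cofactorʳ-degree g′*≋cg′))

  -- Monic polynomials

  record Monic (p : Poly) (n : ℕ) : Set where
    constructor isMonic
    field
      monicDegree : IsDegree p n
      leading≡1   : coeff p n ≡ 1#
  open Monic public

  monic-monic : ∀ {n} (v : Vec F n) → Monic (monic v) n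
  monic-monic v = isMonic (isDegree (λ top≡0 → 1≢0 (trans (sym (top v)) top≡0)) (atMost v)) (top v)
    where
    top : ∀ {n} (v : Vec F n) → coeff (monic v) n ≡ 1#
    top []ᵥ       = refl
    top (a ∷ᵥ v) = top v
    atMost : ∀ {n} (v : Vec F n) → DegreeAtMost (monic v) n
    atMost []ᵥ       (suc i) _         = refl
    atMost (a ∷ᵥ v) (suc i) (s≤s n<i) = atMost v i n<i

  coeffVec : ∀ n → Poly → Vec F n
  coeffVec zero    p = []ᵥ
  coeffVec (suc n) p = coeff p 0 ∷ᵥ coeffVec n (divX p)

  monic-coeffVec : ∀ n {p} → DegreeAtMost p n → coeff p n ≡ 1# → monic (coeffVec n p) ≋ p
  monic-coeffVec zero    {p} p≤0 p₀≡1 = ≋-sym (≋-trans (degreeAtMost-zero p p≤0) (∷-cong p₀≡1 ≋-refl))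
  monic-coeffVec (suc n) {p} p≤n pₙ≡1 = ≋-trans
    (∷-cong refl (monic-coeffVec n (divX-degreeAtMost p p≤n) (trans (sym (coeff-suc p n)) pₙ≡1)))
    (mk≋ λ { zero → refl ; (suc i) → sym (coeff-suc p i) })

  coeffVec-monic : ∀ {n} (v : Vec F n) → coeffVec n (monic v) ≡ v
  coeffVec-monic []ᵥ       = refl
  coeffVec-monic (a ∷ᵥ v) = cong (a ∷ᵥ_) (coeffVec-monic v)

  coeffVec-cong : ∀ n {p r} → p ≋ r → coeffVec n p ≡ coeffVec n r
  coeffVec-cong zero    p≋r = refl
  coeffVec-cong (suc n) p≋r = cong₂ _∷ᵥ_ (coeff-≡ p≋r 0) (coeffVec-cong n (divX-cong p≋r))

  monic-injective : ∀ {n} {v w : Vec F n} → monic v ≋ monic w → v ≡ w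
  monic-injective {n} {v} {w} v≋w = trans (sym (coeffVec-monic v)) (trans (coeffVec-cong n v≋w) (coeffVec-monic w))

  *ₚ-monic : ∀ {p r a b} → Monic p a → Monic r b → Monic (p *ₚ r) (a ℕ.+ b)
  *ₚ-monic {p} {r} {a} (isMonic p° p-top) (isMonic r° r-top) =
    isMonic (*ₚ-degree p° r°) $ trans (proj₂ (*ₚ-degreeAtMost a p r (degreeAtMost p°) (degreeAtMost r°)))
                            (trans (cong₂ _·_ p-top r-top) (*-identityˡ 1#))

  cofactor-monic : ∀ {f g h j b} → (g *ₚ h) ≋ f → Monic g j → Monic f (j ℕ.+ b) → Monic h b
  cofactor-monic {f} {g} {h} {j} {b} gh≋f (isMonic g° g-top) (isMonic f° f-top) with factor-degrees g h f° gh≋f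
  ... | factorDegrees j′ b′ g°′ h° j+b≡j′+b′ with degree-unique g° g°′
  ... | refl with ℕ.+-cancelˡ-≡ j b b′ j+b≡j′+b′
  ... | refl = isMonic h° (begin
    coeff h b                      ≡⟨ *-identityˡ _ ⟨
    1# · coeff h b                 ≡⟨ cong (_· coeff h b) g-top ⟨
    coeff g j · coeff h b          ≡⟨ proj₂ (*ₚ-degreeAtMost j g h (degreeAtMost g°) (degreeAtMost h°)) ⟨
    coeff (g *ₚ h) (j ℕ.+ b)       ≡⟨ coeff-≡ gh≋f (j ℕ.+ b) ⟩
    coeff f (j ℕ.+ b)              ≡⟨ f-top ⟩
    1#                             ∎)
    where open ≡-Reasoning

  -- A divisor of the same degree is a constant multiple, and monicity fixes the constant.
  monic-∣-monic : ∀ {g g′ j} → Monic g j → Monic g′ j → g′ ∣ g → g′ ≋ g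
  monic-∣-monic {g} {g′} {j} g-monic g′-monic (divides w g′w≋g)
    with cofactor-monic g′w≋g g′-monic (subst (Monic g) (sym (ℕ.+-identityʳ j)) g-monic)
  ... | isMonic w° w₀≡1 = ≋-trans (≋-sym (*ₚ-identityʳ g′)) (≋-trans (*ₚ-congʳ g′ w≋1) g′w≋g)
    where
    w≋1 : 1ₚ ≋ w
    w≋1 = ≋-sym (≋-trans (degree-zero w°) (∷-cong w₀≡1 ≋-refl))

  monicNormalisation : ∀ {g h f j} → IsDegree g j → (g *ₚ h) ≋ f →
                       ∃[ c ] (c ≢ 0#) × (coeff (scale c g) j ≡ 1#) × ((scale c g *ₚ scale (coeff g j) h) ≋ f)
  monicNormalisation {g} {h} {f} {j} g° gh≋f with inverse (coeff g j) (leading≢0 g°)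
  ... | c , gⱼc≡1 = c , c≢0 , trans (coeff-scale c g j) (trans (*-comm c _) gⱼc≡1) , (begin
    scale c g *ₚ scale (coeff g j) h           ≈⟨ scale-*ₚ c g _ ⟩
    scale c (g *ₚ scale (coeff g j) h)         ≈⟨ scale-cong refl (*ₚ-scale (coeff g j) g h) ⟩
    scale c (scale (coeff g j) (g *ₚ h))       ≈⟨ scale-scale c (coeff g j) (g *ₚ h) ⟩
    scale (c · coeff g j) (g *ₚ h)             ≈⟨ scale-cong (trans (*-comm c _) gⱼc≡1) ≋-refl ⟩
    scale 1# (g *ₚ h)                          ≈⟨ scale-one (g *ₚ h) ⟩
    g *ₚ h                                     ≈⟨ gh≋f ⟩
    f                                          ∎)
    where
    open ≋-Reasoning
    c≢0 : c ≢ 0#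
    c≢0 c≡0 = 1≢0 (trans (sym gⱼc≡1) (trans (cong (coeff g j ·_) c≡0) (zeroʳ _)))

  cofactor-selfReciprocalFree : ∀ {f g h j} → (g *ₚ h) ≋ f → IsSelfReciprocal g j →
                                (∀ d → SRFactorOfDegree f d → d ≤ j) → SelfReciprocalFree h
  cofactor-selfReciprocalFree {f} {g} {h} {j} gh≋f g* maximal d (k , k∣h , k-sr , k°) =
    ℕ.n≤0⇒n≡0 (ℕ.+-cancelʳ-≤ j d 0 (maximal (d ℕ.+ j) kg-factor))
    where
    k* = fromSelfReciprocal k-sr (fromHasDegree k k°)
    kg∣f : (k *ₚ g) ∣ f
    kg∣f with fromDivides {k} {h} k∣h
    ... | divides y ky≋h = divides y (begin
      (k *ₚ g) *ₚ y    ≈⟨ PolySolver.solve 3 (λ k g y → (k :* g) :* y := g :* (k :* y)) ≋-refl k g y ⟩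
      g *ₚ (k *ₚ y)    ≈⟨ *ₚ-congʳ g ky≋h ⟩
      g *ₚ h           ≈⟨ gh≋f ⟩
      f                ∎)
      where
      open ≋-Reasoning
      open PolySolver using (_:*_; _:=_)
    kg-factor : SRFactorOfDegree f (d ℕ.+ j)
    kg-factor = k *ₚ g , toDivides kg∣f , toSelfReciprocal (*ₚ-selfReciprocal k* g*) , toHasDegree (*ₚ-degree (fromHasDegree k k°) (degree g*))

  module Counting (n j : ℕ) (j≤n : j ≤ n) where
    m = n ∸ j

    monicProduct : Vec F m → Vec F j → Vec F n
    monicProduct h g = coeffVec n (monic h *ₚ monic g)

    monic-monicProduct : ∀ h g → monic (monicProduct h g) ≋ (monic h *ₚ monic g)
    monic-monicProduct h g with *ₚ-monic (monic-monic h) (monic-monic g)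
    ... | isMonic hg° hg-top = monic-coeffVec n (subst (DegreeAtMost (monic h *ₚ monic g)) m+j≡n (degreeAtMost hg°))
                                          (subst (λ i → coeff (monic h *ₚ monic g) i ≡ 1#) m+j≡n hg-top)
      where
      m+j≡n : m ℕ.+ j ≡ n
      m+j≡n = ℕ.m∸n+n≡m j≤n

    monicProduct-∈PSet : ∀ h g → ZSet m h → SSet j g → PSet n j (monicProduct h g)
    monicProduct-∈PSet h g (h₀≢0 , h-free) g-sr =
      f₀≢0 , (monic g , toDivides g∣f , g-sr , toHasDegree g°) , maximal
      where
      f≋hg = monic-monicProduct h g
      g° = monicDegree (monic-monic g)
      g* = fromSelfReciprocal g-sr g°
      f₀≢0 : coeff (monic (monicProduct h g)) 0 ≢ 0#
      f₀≢0 f₀≡0 = ·-nonZero h₀≢0 (const≢0 g*) (trans (sym (coeff-*ₚ-zero (monic h) (monic g))) (trans (sym (coeff-≡ f≋hg 0)) f₀≡0))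
      g∣f : monic g ∣ monic (monicProduct h g)
      g∣f = divides (monic h) (≋-trans (*ₚ-comm (monic g) (monic h)) (≋-sym f≋hg))
      maximal : ∀ d → SRFactorOfDegree (monic (monicProduct h g)) d → d ≤ j
      maximal d (k , k∣f , k-sr , k°) =
        ∣⇒degree-≤ (selfReciprocal-∣-*ₚ⇒∣ {h = monic h} (fromSelfReciprocal k-sr (fromHasDegree k k°)) g* h-free
                                         (∣-respʳ-≋ f≋hg (fromDivides {k} k∣f)))
                   (fromHasDegree k k°) g°

    PSet⇒monicProduct : ∀ {v} → PSet n j v → ∃[ h ] ∃[ g ] ZSet m h × SSet j g × (monicProduct h g ≡ v)
    PSet⇒monicProduct {v} (f₀≢0 , (g , g∣f , g-sr , g°) , maximal) with fromDivides {g} {monic v} g∣f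
    ... | divides h gh≋f with monicNormalisation (fromHasDegree g g°) gh≋f
    ... | c , c≢0 , G-top , GH≋f =
      coeffVec m H , coeffVec j G , (H₀≢0 , H-free) , toSelfReciprocal G′* , monic-injective product≋f
      where
      G = scale c g
      H = scale (coeff g j) h
      G* = scale-selfReciprocal c c≢0 (fromSelfReciprocal g-sr (fromHasDegree g g°))
      f-monic : Monic (monic v) (j ℕ.+ m)
      f-monic = subst (Monic (monic v)) (sym (ℕ.m+[n∸m]≡n j≤n)) (monic-monic v)
      H-monic = cofactor-monic GH≋f (isMonic (degree G*) G-top) f-monic
      G′≋G : monic (coeffVec j G) ≋ G
      G′≋G = monic-coeffVec j (degreeAtMost (degree G*)) G-top
      H′≋H : monic (coeffVec m H) ≋ H
      H′≋H = monic-coeffVec m (degreeAtMost (monicDegree H-monic)) (leading≡1 H-monic)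
      G′* = IsSelfReciprocal-resp-≋ (≋-sym G′≋G) G*
      GH′≋f : (G *ₚ monic (coeffVec m H)) ≋ monic v
      GH′≋f = ≋-trans (*ₚ-congʳ G H′≋H) GH≋f
      H₀≢0 = proj₂ (factors-const≢0 G (monic (coeffVec m H)) GH′≋f f₀≢0)
      H-free = cofactor-selfReciprocalFree GH′≋f G* maximal
      product≋f : monic (monicProduct (coeffVec m H) (coeffVec j G)) ≋ monic v
      product≋f = ≋-trans (monic-monicProduct (coeffVec m H) (coeffVec j G)) (≋-trans (*ₚ-cong H′≋H G′≋G) (≋-trans (*ₚ-comm H G) GH≋f))

    monicProduct-injective : ∀ h g h′ g′ → ZSet m h → SSet j g → ZSet m h′ → SSet j g′ →
                             monicProduct h g ≡ monicProduct h′ g′ → h ≡ h′ × g ≡ g′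
    monicProduct-injective h g h′ g′ (_ , h-free) g-sr _ g′-sr hg≡h′g′ =
      monic-injective (*ₚ-cancelˡ (monic h) (monic h′) (monicDegree (monic-monic g)) gh≋gh′) , monic-injective g≋g′
      where
      hg≋h′g′ : (monic h *ₚ monic g) ≋ (monic h′ *ₚ monic g′)
      hg≋h′g′ = ≋-trans (≋-sym (monic-monicProduct h g))
                (≋-trans (mk≋ λ i → cong (λ v → coeff (monic v) i) hg≡h′g′) (monic-monicProduct h′ g′))
      g′∣g : monic g′ ∣ monic g
      g′∣g = selfReciprocal-∣-*ₚ⇒∣ {h = monic h} (fromSelfReciprocal g′-sr (monicDegree (monic-monic g′)))
                                   (fromSelfReciprocal g-sr (monicDegree (monic-monic g))) h-free
                                   (divides (monic h′) (≋-trans (*ₚ-comm (monic g′) (monic h′)) (≋-sym hg≋h′g′)))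
      g≋g′ : monic g ≋ monic g′
      g≋g′ = ≋-sym (monic-∣-monic (monic-monic g) (monic-monic g′) g′∣g)
      gh≋gh′ : (monic g *ₚ monic h) ≋ (monic g *ₚ monic h′)
      gh≋gh′ = ≋-trans (*ₚ-comm (monic g) (monic h))
               (≋-trans hg≋h′g′ (≋-trans (*ₚ-congʳ (monic h′) (≋-sym g≋g′)) (*ₚ-comm (monic h′) (monic g))))

mainTheorem3 : (𝔽 : FiniteField) → (n j : ℕ) → 1 ≤ j → j ≤ n →
    (Lp : List (Vec (FiniteField.F 𝔽) n)) → Enumerates (Polynomials.PSet 𝔽 n j) Lp →
    (Lz : List (Vec (FiniteField.F 𝔽) (n ∸ j))) → Enumerates (Polynomials.ZSet 𝔽 (n ∸ j)) Lz →
    (Ls : List (Vec (FiniteField.F 𝔽) j)) → Enumerates (Polynomials.SSet 𝔽 j) Ls →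
    length Lp ≡ length Lz * length Ls
mainTheorem3 𝔽 n j _ j≤n Lp Lp-enum Lz Lz-enum Ls Ls-enum =
  enumerates-product monicProduct Lz-enum Ls-enum Lp-enum monicProduct-∈PSet PSet⇒monicProduct monicProduct-injective
  where open SelfReciprocalFactors.Counting 𝔽 n j j≤n
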